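{- Let $\xi_0(q)$ be the unique formal power series in $q$ with $\Theta_0(-\xi_0(q),q)=0$, where $\Theta_0(x,q)=\sum_{n\ge0}x^nq^{\binom n2}$. Then $$\xi_0(q)=\sum_{T}q^{A(T)},$$ where the sum runs over all (finite) $S_q$-enriched rooted trees $T$ and $A(T)$ is the total area of the stack polyominoes decorating the vertices of $T$. In particular, for each $A\ge0$ the coefficient of $q^A$ in $\xi_0(q)$ equals the (finite) number of $S_q$-enriched rooted trees of total area $A$, and hence all coefficients of $\xi_0(q)$ are positive integers.
   Context: A stack polyomino is a finite unimodal sequence of positive integers $h_1\le\dots\le h_j<h_{j+1}\ge\dots\ge h_m$ with $m\ge1$, $0\le j\le m-1$; its rise is $j$ and its area is $\sum_i h_i$. The class $S_q$ consists of all stack polyominoes together with one additional "empty polyomino" of rise $0$ and area $0$; the size of an element is its rise. An $S_q$-enriched rooted tree is a finite ordered (plane) rooted tree in which each vertex with out-degree (number of children) $d$ is decorated by an element of $S_q$ of rise $d$; its total area is the sum of the areas of all decorations. -}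

module Defs where

open import Data.Nat using (ℕ; zero; suc; _+_; _∸_; _≤_; _<_; _≥_; _≤?_)
open import Data.Nat.Combinatorics using (_C_)
open import Data.Integer as ℤ using (ℤ; +_)
open import Data.List using (List; []; _∷_)
open import Data.Nat.ListAction using (sum)
open import Data.List.Relation.Unary.All using (All)
open import Data.List.Relation.Unary.Linked using (Linked)
open import Data.Vec using (Vec; []; _∷_)
open import Data.Product using (Σ)
open import Relation.Binary.PropositionalEquality using (_≡_)
open import Relation.Nullary using (yes; no)

-- IsStack j hs : the sequence hs = h₁ … hₘ (m ≥ 1) satisfies
--   h₁ ≤ … ≤ hⱼ < hⱼ₊₁ ≥ … ≥ hₘ , i.e. it is unimodal with rise j.
data IsStack : ℕ → List ℕ → Set where
  peak  : ∀ {h t} → Linked _≥_ (h ∷ t) → IsStack 0 (h ∷ t)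
  rise1 : ∀ {h h' t} → h < h' → IsStack 0 (h' ∷ t) → IsStack 1 (h ∷ h' ∷ t)
  riseS : ∀ {j h h' t} → h ≤ h' → IsStack (suc j) (h' ∷ t) →
          IsStack (suc (suc j)) (h ∷ h' ∷ t)

data Sq : ℕ → Set where
  emptyPoly : Sq 0
  stack     : ∀ {d} (hs : List ℕ) → All (0 <_) hs → IsStack d hs → Sq d

sqArea : ∀ {d} → Sq d → ℕ
sqArea emptyPoly      = 0
sqArea (stack hs _ _) = sum hs

-- S_q-enriched plane rooted trees: a vertex with d (ordered) children
-- carries a decoration of rise d.

data Tree : Set where
  node : (d : ℕ) → Sq d → Vec Tree d → Tree

mutual
  area : Tree → ℕ
  area (node d s ts) = sqArea s + areas ts

  areas : ∀ {d} → Vec Tree d → ℕ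
  areas []       = 0
  areas (t ∷ ts) = area t + areas ts

TreesOfArea : ℕ → Set
TreesOfArea A = Σ Tree (λ t → area t ≡ A)

PS : Set
PS = ℕ → ℤ

sumTo : ℕ → (ℕ → ℤ) → ℤ
sumTo zero    h = h 0
sumTo (suc n) h = sumTo n h ℤ.+ h (suc n)

_⊛_ : PS → PS → PS
(f ⊛ g) n = sumTo n (λ k → f k ℤ.* g (n ∸ k))

one : PS
one zero    = + 1
one (suc _) = + 0

negPS : PS → PS
negPS f n = ℤ.- f n

powPS : PS → ℕ → PS
powPS f zero    = one
powPS f (suc n) = f ⊛ powPS f n

shift : ℕ → PS → PS
shift k g A with k ≤? A
... | yes _ = g (A ∸ k)
... | no  _ = + 0

-- The coefficient of q^A only receives contributions from n with
-- (n choose 2) ≤ A, all of which satisfy n ≤ A + 1, so the sum is finite.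
Θ₀ : PS → PS
Θ₀ g A = sumTo (suc A) (λ n → shift (n C 2) (powPS g n) A)

IsΘ₀Root : PS → Set
IsΘ₀Root f = ∀ A → Θ₀ (negPS f) A ≡ + 0

-- Cutting a tree at its root, an S_q-enriched tree is either the empty polyomino or a
-- stack with peak p, a weakly increasing sequence of columns of heights in [1, p), one per
-- child and each carrying that child's subtree, and a partition with parts ≤ p.  So the
-- area series t satisfies t = 1 + Σ_{p≥1} q^p L_p R_p with L_p = 1/∏_{0<i<p}(1 − t q^i) and
-- R_p = 1/∏_{0<i≤p}(1 − q^i).  Both W(y) = Σ_p q^p (y q^p; q)_∞ (q^(p+1); q)_∞ and Θ₀(−y)
-- satisfy F(y) = (1 − y) F(yq) + yq F(yq²) and F(0) = 1, hence agree, and the tree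
-- equation makes W(t) vanish.  Uniqueness holds because the coefficient of q^A in
-- Θ₀(−f) is [A = 0] − f_A plus terms in f_0, …, f_(A−1).  Everything is done modulo
-- q^(M+1) for each M, so that all products are finite.

module Submission where

open import Defs
open import Data.Nat as ℕ using (ℕ; zero; suc; _∸_; _≤_; _<_; _≥_; z≤n; s≤s; _≤?_)
import Data.Nat.Properties as ℕP
open import Data.Nat.Combinatorics using (_C_; nC1≡n; nCk+nC[k+1]≡[n+1]C[k+1])
open import Data.Nat.ListAction using (sum)
open import Data.Integer as ℤ using (ℤ; +_; _+_; _*_; -_)
import Data.Integer.Properties as ℤP
open import Data.Integer.Tactic.RingSolver using (solve-∀)
open import Data.Empty using (⊥-elim)
open import Data.Unit using (⊤; tt)
open import Data.Fin as Fin using (Fin)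
import Data.Fin.Properties as FinP
open import Data.Fin.Permutation using (↔⇒≡)
open import Data.List using (List; []; _∷_)
open import Data.List.Relation.Unary.All using (All; []; _∷_)
open import Data.List.Relation.Unary.Linked using (Linked; []; [-]; _∷_)
open import Data.Vec using (Vec; []; _∷_)
open import Data.Maybe using (Maybe; just; nothing)
open import Data.Product using (Σ; _×_; _,_; proj₁; proj₂)
open import Data.Product.Function.NonDependent.Propositional using (_×-cong_)
open import Data.Sum using (_⊎_; inj₁; inj₂; [_,_]′)
open import Data.Sum.Function.Propositional using (_⊎-cong_)
open import Algebra.Bundles using (CommutativeRing)
open import Algebra.Properties.CommutativeSemigroup ℕP.+-commutativeSemigroup using (x∙yz≈y∙xz)
import Algebra.Properties.CommutativeSemigroup ℤP.+-commutativeSemigroup as ℤ+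
import Algebra.Solver.Ring.AlmostCommutativeRing as ACR
open import Function using (_∘_)
open import Function.Bundles using (_↔_; Inverse; mk↔ₛ′)
open import Function.Properties.Inverse using (↔-refl; ↔-sym; ↔-trans)
open import Relation.Binary.Bundles using (Setoid)
import Relation.Binary.Reasoning.Setoid as SetoidReasoning
open import Relation.Binary.PropositionalEquality
open import Relation.Nullary using (¬_; yes; no)
open import Relation.Nullary.Decidable using (recompute)
open import Relation.Nullary.Negation using (contradiction)

-- The ring of formal power series

sumTo-cong : ∀ n {f g : ℕ → ℤ} → (∀ i → i ≤ n → f i ≡ g i) → sumTo n f ≡ sumTo n g
sumTo-cong zero    e = e 0 z≤n
sumTo-cong (suc n) e = cong₂ _+_ (sumTo-cong n (λ i i≤n → e i (ℕP.m≤n⇒m≤1+n i≤n))) (e (suc n) ℕP.≤-refl)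

sumTo-+ : ∀ n (f g : ℕ → ℤ) → sumTo n (λ i → f i + g i) ≡ sumTo n f + sumTo n g
sumTo-+ zero    f g = refl
sumTo-+ (suc n) f g = trans (cong (_+ (f (suc n) + g (suc n))) (sumTo-+ n f g))
  (ℤ+.interchange (sumTo n f) (sumTo n g) _ _)

sumTo-head : ∀ n (f : ℕ → ℤ) → sumTo (suc n) f ≡ f 0 + sumTo n (f ∘ suc)
sumTo-head zero    f = refl
sumTo-head (suc n) f = trans (cong (_+ f (suc (suc n))) (sumTo-head n f))
  (ℤP.+-assoc (f 0) (sumTo n (f ∘ suc)) (f (suc (suc n))))

sumTo-reverse : ∀ n (f : ℕ → ℤ) → sumTo n f ≡ sumTo n (λ i → f (n ∸ i))
sumTo-reverse zero    f = refl
sumTo-reverse (suc n) f = sym (trans (sumTo-head n (λ i → f (suc n ∸ i)))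
  (trans (cong (λ x → f (suc n) + x) (sym (sumTo-reverse n f))) (ℤP.+-comm (f (suc n)) (sumTo n f))))

sumTo-*ˡ : ∀ n a (f : ℕ → ℤ) → a * sumTo n f ≡ sumTo n (λ i → a * f i)
sumTo-*ˡ zero    a f = refl
sumTo-*ˡ (suc n) a f = trans (ℤP.*-distribˡ-+ a (sumTo n f) (f (suc n)))
  (cong (_+ a * f (suc n)) (sumTo-*ˡ n a f))

sumTo-*ʳ : ∀ n a (f : ℕ → ℤ) → sumTo n f * a ≡ sumTo n (λ i → f i * a)
sumTo-*ʳ n a f = trans (ℤP.*-comm (sumTo n f) a)
  (trans (sumTo-*ˡ n a f) (sumTo-cong n (λ i _ → ℤP.*-comm a (f i))))

sumTo-zero : ∀ n → sumTo n (λ _ → + 0) ≡ + 0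
sumTo-zero zero    = refl
sumTo-zero (suc n) = cong (_+ + 0) (sumTo-zero n)

sumTo-exchange : ∀ n (F : ℕ → ℕ → ℤ) →
  sumTo n (λ k → sumTo k (λ j → F j k)) ≡ sumTo n (λ j → sumTo (n ∸ j) (λ i → F j (j ℕ.+ i)))
sumTo-exchange zero    F = refl
sumTo-exchange (suc n) F = begin
    sumTo n (λ k → sumTo k (λ j → F j k)) + (sumTo n (λ j → F j (suc n)) + F (suc n) (suc n))
  ≡⟨ cong (_+ (sumTo n (λ j → F j (suc n)) + F (suc n) (suc n))) (sumTo-exchange n F) ⟩
    sumTo n G + (sumTo n (λ j → F j (suc n)) + F (suc n) (suc n))
  ≡⟨ sym (ℤP.+-assoc (sumTo n G) _ _) ⟩
    (sumTo n G + sumTo n (λ j → F j (suc n))) + F (suc n) (suc n)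
  ≡⟨ cong₂ _+_ (sym (sumTo-+ n G (λ j → F j (suc n)))) (cong (F (suc n)) (sym (ℕP.+-identityʳ (suc n)))) ⟩
    sumTo n (λ j → G j + F j (suc n)) + F (suc n) (suc n ℕ.+ 0)
  ≡⟨ cong (_+ F (suc n) (suc n ℕ.+ 0)) (sumTo-cong n extend) ⟩
    sumTo n G′ + F (suc n) (suc n ℕ.+ 0)
  ≡⟨ cong (λ m → sumTo n G′ + sumTo m (λ i → F (suc n) (suc n ℕ.+ i))) (sym (ℕP.n∸n≡0 n)) ⟩
    sumTo n G′ + G′ (suc n)
  ∎
  where
  open ≡-Reasoning
  G G′ : ℕ → ℤ
  G  j = sumTo (n ∸ j) (λ i → F j (j ℕ.+ i))
  G′ j = sumTo (suc n ∸ j) (λ i → F j (j ℕ.+ i))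
  extend : ∀ j → j ≤ n → G j + F j (suc n) ≡ G′ j
  extend j j≤n = sym (trans (cong (λ m → sumTo m (λ i → F j (j ℕ.+ i))) (ℕP.+-∸-assoc 1 j≤n))
    (cong (λ x → G j + x) (cong (F j) (trans (ℕP.+-suc j (n ∸ j)) (cong suc (ℕP.m+[n∸m]≡n j≤n))))))

infixl 6 _⊕_ _⊖_

_⊕_ : PS → PS → PS
(f ⊕ g) n = f n + g n

_⊖_ : PS → PS → PS
f ⊖ g = f ⊕ negPS g

𝟘 : PS
𝟘 _ = + 0

⊛-comm : ∀ f g → f ⊛ g ≗ g ⊛ f
⊛-comm f g n = trans (sumTo-reverse n _) (sumTo-cong n (λ k k≤n →
  trans (cong (λ m → f (n ∸ k) * g m) (ℕP.m∸[m∸n]≡n k≤n)) (ℤP.*-comm (f (n ∸ k)) (g k))))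

⊛-identityˡ : ∀ g → one ⊛ g ≗ g
⊛-identityˡ g zero    = ℤP.*-identityˡ (g 0)
⊛-identityˡ g (suc n) = begin
    sumTo (suc n) (λ k → one k * g (suc n ∸ k))
  ≡⟨ sumTo-head n _ ⟩
    + 1 * g (suc n) + sumTo n (λ k → + 0 * g (n ∸ k))
  ≡⟨ cong₂ _+_ (ℤP.*-identityˡ (g (suc n))) (sumTo-zero n) ⟩
    g (suc n) + + 0
  ≡⟨ ℤP.+-identityʳ _ ⟩
    g (suc n) ∎
  where open ≡-Reasoning

⊛-distribˡ : ∀ f g h → f ⊛ (g ⊕ h) ≗ (f ⊛ g) ⊕ (f ⊛ h)
⊛-distribˡ f g h n = trans (sumTo-cong n (λ k _ → ℤP.*-distribˡ-+ (f k) (g (n ∸ k)) (h (n ∸ k))))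
  (sumTo-+ n _ _)

⊛-assoc : ∀ f g h → (f ⊛ g) ⊛ h ≗ f ⊛ (g ⊛ h)
⊛-assoc f g h n = begin
    sumTo n (λ k → sumTo k (λ j → f j * g (k ∸ j)) * h (n ∸ k))
  ≡⟨ sumTo-cong n (λ k _ → sumTo-*ʳ k (h (n ∸ k)) _) ⟩
    sumTo n (λ k → sumTo k (λ j → f j * g (k ∸ j) * h (n ∸ k)))
  ≡⟨ sumTo-exchange n (λ j k → f j * g (k ∸ j) * h (n ∸ k)) ⟩
    sumTo n (λ j → sumTo (n ∸ j) (λ i → f j * g (j ℕ.+ i ∸ j) * h (n ∸ (j ℕ.+ i))))
  ≡⟨ sumTo-cong n (λ j _ → trans (sumTo-cong (n ∸ j) (λ i _ →
        trans (cong₂ (λ a b → f j * g a * h b) (ℕP.m+n∸m≡n j i) (sym (ℕP.∸-+-assoc n j i)))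
              (ℤP.*-assoc (f j) (g i) (h (n ∸ j ∸ i)))))
        (sym (sumTo-*ˡ (n ∸ j) (f j) _))) ⟩
    sumTo n (λ j → f j * sumTo (n ∸ j) (λ i → g i * h (n ∸ j ∸ i)))
  ∎
  where open ≡-Reasoning

psRing : CommutativeRing _ _
psRing = record
  { Carrier = PS ; _≈_ = _≗_ ; _+_ = _⊕_ ; _*_ = _⊛_ ; -_ = negPS ; 0# = 𝟘 ; 1# = one
  ; isCommutativeRing = record
    { isRing = record
      { +-isAbelianGroup = record
        { isGroup = record
          { isMonoid = record
            { isSemigroup = record
              { isMagma = record
                { isEquivalence = record { refl = λ _ → refl ; sym = λ e n → sym (e n)
                                         ; trans = λ e e′ n → trans (e n) (e′ n) }
                ; ∙-cong = λ e e′ n → cong₂ _+_ (e n) (e′ n) }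
              ; assoc = λ f g h n → ℤP.+-assoc (f n) (g n) (h n) }
            ; identity = (λ f n → ℤP.+-identityˡ (f n)) , (λ f n → ℤP.+-identityʳ (f n)) }
          ; inverse = (λ f n → ℤP.+-inverseˡ (f n)) , (λ f n → ℤP.+-inverseʳ (f n))
          ; ⁻¹-cong = λ e n → cong -_ (e n) }
        ; comm = λ f g n → ℤP.+-comm (f n) (g n) }
      ; *-cong = λ e e′ n → sumTo-cong n (λ k _ → cong₂ _*_ (e k) (e′ (n ∸ k)))
      ; *-assoc = ⊛-assoc
      ; *-identity = ⊛-identityˡ , (λ g n → trans (⊛-comm g one n) (⊛-identityˡ g n))
      ; distrib = ⊛-distribˡ , (λ f g h n → trans (⊛-comm (g ⊕ h) f n)
                     (trans (⊛-distribˡ f g h n) (cong₂ _+_ (⊛-comm f g n) (⊛-comm f h n))))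
      }
    ; *-comm = ⊛-comm
    }
  }

module PS = CommutativeRing psRing

-- The first two clauses make the solver's constants 0 and 1 definitionally 𝟘 and one.
constPS : ℤ → PS
constPS (+ 0)   = 𝟘
constPS (+ 1)   = one
constPS c zero    = c
constPS c (suc _) = + 0

private
  constPS-zero : ∀ c → constPS c 0 ≡ c
  constPS-zero (+ 0)           = refl
  constPS-zero (+ 1)           = refl
  constPS-zero (+ suc (suc n)) = refl
  constPS-zero ℤ.-[1+ n ]      = refl

  constPS-suc : ∀ c n → constPS c (suc n) ≡ + 0
  constPS-suc (+ 0)           n = refl
  constPS-suc (+ 1)           n = refl
  constPS-suc (+ suc (suc m)) n = refl
  constPS-suc ℤ.-[1+ m ]      n = refl

  constPS-homo-* : ∀ a b → constPS (a * b) ≗ constPS a ⊛ constPS b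
  constPS-homo-* a b zero    = trans (constPS-zero (a * b)) (sym (cong₂ _*_ (constPS-zero a) (constPS-zero b)))
  constPS-homo-* a b (suc n) = sym (begin
      sumTo (suc n) (λ k → constPS a k * constPS b (suc n ∸ k))
    ≡⟨ sumTo-head n _ ⟩
      constPS a 0 * constPS b (suc n) + sumTo n (λ k → constPS a (suc k) * constPS b (n ∸ k))
    ≡⟨ cong₂ _+_ (trans (cong (constPS a 0 *_) (constPS-suc b n)) (ℤP.*-zeroʳ (constPS a 0)))
        (trans (sumTo-cong n (λ k _ → cong (_* constPS b (n ∸ k)) (constPS-suc a k))) (sumTo-zero n)) ⟩
      + 0
    ≡⟨ sym (constPS-suc (a * b) n) ⟩
      constPS (a * b) (suc n) ∎)
    where open ≡-Reasoning

  constPS-homo : ℤ.+-*-rawRing ACR.-Raw-AlmostCommutative⟶ ACR.fromCommutativeRing psRing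
  constPS-homo = record
    { ⟦_⟧    = constPS
    ; +-homo = λ { a b zero → trans (constPS-zero (a + b)) (sym (cong₂ _+_ (constPS-zero a) (constPS-zero b)))
                 ; a b (suc n) → trans (constPS-suc (a + b) n) (sym (cong₂ _+_ (constPS-suc a n) (constPS-suc b n))) }
    ; *-homo = constPS-homo-*
    ; -‿homo = λ { a zero → trans (constPS-zero (- a)) (sym (cong -_ (constPS-zero a)))
                 ; a (suc n) → trans (constPS-suc (- a) n) (sym (cong -_ (constPS-suc a n))) }
    ; 0-homo = λ _ → refl
    ; 1-homo = λ _ → refl
    }

  constPS-≟ : ∀ a b → Maybe (constPS a ≗ constPS b)
  constPS-≟ a b with a ℤ.≟ b
  ... | yes refl = just (λ _ → refl)
  ... | no _     = nothing

open import Algebra.Solver.Ring ℤ.+-*-rawRing (ACR.fromCommutativeRing psRing) constPS-homo constPS-≟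
  using (solve; _:=_; _:+_; _:*_; :-_; _:-_; con)


-- Truncated power series

infix 4 _≈[_]_

_≈[_]_ : PS → ℕ → PS → Set
f ≈[ N ] g = ∀ k → k < N → f k ≡ g k

≈-refl : ∀ {N} f → f ≈[ N ] f
≈-refl _ _ _ = refl

≈-sym : ∀ {N f g} → f ≈[ N ] g → g ≈[ N ] f
≈-sym e k k<N = sym (e k k<N)

≈-trans : ∀ {N f g h} → f ≈[ N ] g → g ≈[ N ] h → f ≈[ N ] h
≈-trans e e′ k k<N = trans (e k k<N) (e′ k k<N)

≗⇒≈ : ∀ {N f g} → f ≗ g → f ≈[ N ] g
≗⇒≈ e k _ = e k

≈-setoid : ℕ → Setoid _ _
≈-setoid N = record
  { Carrier = PS ; _≈_ = _≈[ N ]_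
  ; isEquivalence = record { refl = λ {f} → ≈-refl f ; sym = ≈-sym ; trans = ≈-trans } }

⊕-cong-≈ : ∀ {N f f′ g g′} → f ≈[ N ] f′ → g ≈[ N ] g′ → f ⊕ g ≈[ N ] f′ ⊕ g′
⊕-cong-≈ e e′ k k<N = cong₂ _+_ (e k k<N) (e′ k k<N)

neg-cong-≈ : ∀ {N f f′} → f ≈[ N ] f′ → negPS f ≈[ N ] negPS f′
neg-cong-≈ e k k<N = cong -_ (e k k<N)

⊛-cong-≈ : ∀ {N f f′ g g′} → f ≈[ N ] f′ → g ≈[ N ] g′ → f ⊛ g ≈[ N ] f′ ⊛ g′
⊛-cong-≈ e e′ k k<N = sumTo-cong k (λ i i≤k →
  cong₂ _*_ (e i (ℕP.≤-<-trans i≤k k<N)) (e′ (k ∸ i) (ℕP.≤-<-trans (ℕP.m∸n≤m k i) k<N)))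

pow-cong-≈ : ∀ {N f f′} n → f ≈[ N ] f′ → powPS f n ≈[ N ] powPS f′ n
pow-cong-≈ zero    e = ≈-refl one
pow-cong-≈ (suc n) e = ⊛-cong-≈ e (pow-cong-≈ n e)

q : PS
q 1 = + 1
q _ = + 0

infix 25 q^_

q^_ : ℕ → PS
q^ k = powPS q k

shift-suc : ∀ k g m → shift (suc k) g (suc m) ≡ shift k g m
shift-suc k g m with suc k ≤? suc m | k ≤? m
... | yes _     | yes _   = refl
... | no _      | no _    = refl
... | yes 1+k≤ | no k≰m  = contradiction (ℕP.≤-pred 1+k≤) k≰m
... | no 1+k≰  | yes k≤m = contradiction (s≤s k≤m) 1+k≰

q⊛≗shift : ∀ h → q ⊛ h ≗ shift 1 h
q⊛≗shift h zero          = refl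
q⊛≗shift h (suc zero)    = trans (cong (λ x → + 0 * h 1 + x) (ℤP.*-identityˡ (h 0))) (ℤP.+-identityˡ (h 0))
q⊛≗shift h (suc (suc m)) = begin
    sumTo (suc (suc m)) (λ i → q i * h (suc (suc m) ∸ i))
  ≡⟨ sumTo-head (suc m) _ ⟩
    + 0 * h (suc (suc m)) + sumTo (suc m) (λ i → q (suc i) * h (suc m ∸ i))
  ≡⟨ ℤP.+-identityˡ _ ⟩
    sumTo (suc m) (λ i → q (suc i) * h (suc m ∸ i))
  ≡⟨ sumTo-head m _ ⟩
    + 1 * h (suc m) + sumTo m (λ i → + 0 * h (m ∸ i))
  ≡⟨ cong₂ _+_ (ℤP.*-identityˡ (h (suc m))) (sumTo-zero m) ⟩
    h (suc m) + + 0
  ≡⟨ ℤP.+-identityʳ _ ⟩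
    h (suc m) ∎
  where open ≡-Reasoning

shift≗q^⊛ : ∀ k g → shift k g ≗ q^ k ⊛ g
shift≗q^⊛ zero    g n       = sym (⊛-identityˡ g n)
shift≗q^⊛ (suc k) g zero    = sym (trans (⊛-assoc q (q^ k) g 0) (q⊛≗shift (q^ k ⊛ g) 0))
shift≗q^⊛ (suc k) g (suc m) = sym (trans (⊛-assoc q (q^ k) g (suc m))
  (trans (q⊛≗shift (q^ k ⊛ g) (suc m)) (trans (sym (shift≗q^⊛ k g m)) (sym (shift-suc k g m)))))

shift-below : ∀ k g n → n < k → shift k g n ≡ + 0
shift-below k g n n<k with k ≤? n
... | yes k≤n = contradiction k≤n (ℕP.<⇒≱ n<k)
... | no _    = refl

shift-cong : ∀ k {f g : PS} → f ≗ g → shift k f ≗ shift k g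
shift-cong k e A with k ≤? A
... | yes _ = e (A ∸ k)
... | no _  = refl

q^⊛≈𝟘 : ∀ {N} k g → N ≤ k → q^ k ⊛ g ≈[ N ] 𝟘
q^⊛≈𝟘 k g N≤k n n<N = trans (sym (shift≗q^⊛ k g n)) (shift-below k g n (ℕP.<-≤-trans n<N N≤k))

q^-+ : ∀ a b → q^ (a ℕ.+ b) ≗ q^ a ⊛ q^ b
q^-+ zero    b = PS.sym (PS.*-identityˡ (q^ b))
q^-+ (suc a) b = PS.trans (PS.*-cong (PS.refl {q}) (q^-+ a b)) (PS.sym (PS.*-assoc q (q^ a) (q^ b)))

Sum : (ℕ → PS) → ℕ → ℕ → PS
Sum g lo zero      = 𝟘
Sum g lo (suc len) = g lo ⊕ Sum g (suc lo) len

Prod : (ℕ → PS) → ℕ → ℕ → PS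
Prod f lo zero      = one
Prod f lo (suc len) = f lo ⊛ Prod f (suc lo) len

Sum-cong-≈ : ∀ {N} g g′ lo len → (∀ i → lo ≤ i → g i ≈[ N ] g′ i) → Sum g lo len ≈[ N ] Sum g′ lo len
Sum-cong-≈ g g′ lo zero      e = ≈-refl 𝟘
Sum-cong-≈ g g′ lo (suc len) e =
  ⊕-cong-≈ (e lo ℕP.≤-refl) (Sum-cong-≈ g g′ (suc lo) len (λ i lo<i → e i (ℕP.<⇒≤ lo<i)))

Prod-cong-≈ : ∀ {N} f f′ lo len → (∀ i → lo ≤ i → f i ≈[ N ] f′ i) → Prod f lo len ≈[ N ] Prod f′ lo len
Prod-cong-≈ f f′ lo zero      e = ≈-refl one
Prod-cong-≈ f f′ lo (suc len) e =
  ⊛-cong-≈ (e lo ℕP.≤-refl) (Prod-cong-≈ f f′ (suc lo) len (λ i lo<i → e i (ℕP.<⇒≤ lo<i)))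

Sum-≈𝟘 : ∀ {N} g lo len → (∀ i → lo ≤ i → g i ≈[ N ] 𝟘) → Sum g lo len ≈[ N ] 𝟘
Sum-≈𝟘 g lo len e = ≈-trans (Sum-cong-≈ g (λ _ → 𝟘) lo len e) (≗⇒≈ (all𝟘 lo len))
  where
  all𝟘 : ∀ lo len → Sum (λ _ → 𝟘) lo len ≗ 𝟘
  all𝟘 lo zero      = PS.refl
  all𝟘 lo (suc len) = PS.trans (PS.+-cong (PS.refl {𝟘}) (all𝟘 (suc lo) len)) (PS.+-identityˡ 𝟘)

Prod-≈one : ∀ {N} f lo len → (∀ i → lo ≤ i → f i ≈[ N ] one) → Prod f lo len ≈[ N ] one
Prod-≈one f lo len e = ≈-trans (Prod-cong-≈ f (λ _ → one) lo len e) (≗⇒≈ (allOne lo len))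
  where
  allOne : ∀ lo len → Prod (λ _ → one) lo len ≗ one
  allOne lo zero      = PS.refl
  allOne lo (suc len) = PS.trans (PS.*-cong (PS.refl {one}) (allOne (suc lo) len)) (PS.*-identityˡ one)

Sum-suc : ∀ g lo len → Sum g (suc lo) len ≗ Sum (g ∘ suc) lo len
Sum-suc g lo zero      = PS.refl
Sum-suc g lo (suc len) = PS.+-cong (PS.refl {g (suc lo)}) (Sum-suc g (suc lo) len)

Prod-suc : ∀ f lo len → Prod f (suc lo) len ≗ Prod (f ∘ suc) lo len
Prod-suc f lo zero      = PS.refl
Prod-suc f lo (suc len) = PS.*-cong (PS.refl {f (suc lo)}) (Prod-suc f (suc lo) len)

Sum-snoc : ∀ g lo len → Sum g lo (suc len) ≗ Sum g lo len ⊕ g (lo ℕ.+ len)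
Sum-snoc g lo zero      n = trans (ℤP.+-identityʳ (g lo n))
  (trans (sym (ℤP.+-identityˡ (g lo n))) (cong (λ m → + 0 + g m n) (sym (ℕP.+-identityʳ lo))))
Sum-snoc g lo (suc len) n = trans (cong (λ x → g lo n + x) (Sum-snoc g (suc lo) len n))
  (trans (sym (ℤP.+-assoc (g lo n) _ _)) (cong (λ m → g lo n + Sum g (suc lo) len n + g m n) (sym (ℕP.+-suc lo len))))

Prod-split : ∀ f lo m n → Prod f lo (m ℕ.+ n) ≗ Prod f lo m ⊛ Prod f (lo ℕ.+ m) n
Prod-split f lo zero    n = PS.trans (PS.sym (PS.*-identityˡ _))
  (λ k → cong (λ j → (one ⊛ Prod f j n) k) (sym (ℕP.+-identityʳ lo)))
Prod-split f lo (suc m) n = PS.trans (PS.*-cong (PS.refl {f lo}) (Prod-split f (suc lo) m n))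
  (PS.trans (PS.sym (PS.*-assoc (f lo) (Prod f (suc lo) m) (Prod f (suc lo ℕ.+ m) n)))
    (λ k → cong (λ j → ((f lo ⊛ Prod f (suc lo) m) ⊛ Prod f j n) k) (sym (ℕP.+-suc lo m))))

Prod-snoc : ∀ f lo len → Prod f lo (suc len) ≗ Prod f lo len ⊛ f (lo ℕ.+ len)
Prod-snoc f lo len = PS.trans (λ k → cong (λ m → Prod f lo m k) (ℕP.+-comm 1 len))
  (PS.trans (Prod-split f lo len 1) (PS.*-cong (PS.refl {Prod f lo len}) (PS.*-identityʳ (f (lo ℕ.+ len)))))

Sum-⊕ : ∀ g h lo len → Sum (λ i → g i ⊕ h i) lo len ≗ Sum g lo len ⊕ Sum h lo len
Sum-⊕ g h lo zero      = PS.sym (PS.+-identityˡ 𝟘)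
Sum-⊕ g h lo (suc len) = PS.trans (PS.+-cong (PS.refl {g lo ⊕ h lo}) (Sum-⊕ g h (suc lo) len))
  (solve 4 (λ a b c d → (a :+ b) :+ (c :+ d) := (a :+ c) :+ (b :+ d)) (λ _ → refl) (g lo) (h lo) _ _)

Sum-⊛ˡ : ∀ c g lo len → c ⊛ Sum g lo len ≗ Sum (λ i → c ⊛ g i) lo len
Sum-⊛ˡ c g lo zero      = PS.zeroʳ c
Sum-⊛ˡ c g lo (suc len) = PS.trans (PS.distribˡ c (g lo) (Sum g (suc lo) len))
  (PS.+-cong (PS.refl {c ⊛ g lo}) (Sum-⊛ˡ c g (suc lo) len))

Sum-⊛ʳ : ∀ g lo len c → Sum g lo len ⊛ c ≗ Sum (λ i → g i ⊛ c) lo len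
Sum-⊛ʳ g lo len c = PS.trans (PS.*-comm (Sum g lo len) c) (PS.trans (Sum-⊛ˡ c g lo len)
  (Sum-cong≗ lo len (λ i → PS.*-comm c (g i))))
  where
  Sum-cong≗ : ∀ lo len → (∀ i → c ⊛ g i ≗ g i ⊛ c) → Sum (λ i → c ⊛ g i) lo len ≗ Sum (λ i → g i ⊛ c) lo len
  Sum-cong≗ lo zero      e = PS.refl
  Sum-cong≗ lo (suc len) e = PS.+-cong (e lo) (Sum-cong≗ (suc lo) len e)

Sum-neg : ∀ g lo len → negPS (Sum g lo len) ≗ Sum (λ i → negPS (g i)) lo len
Sum-neg g lo zero      n = refl
Sum-neg g lo (suc len) = PS.trans (λ n → ℤP.neg-distrib-+ (g lo n) (Sum g (suc lo) len n))
  (PS.+-cong (PS.refl {negPS (g lo)}) (Sum-neg g (suc lo) len))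

Sum-⊖ : ∀ g h lo len → Sum (λ i → g i ⊖ h i) lo len ≗ Sum g lo len ⊖ Sum h lo len
Sum-⊖ g h lo len = PS.trans (Sum-⊕ g (λ i → negPS (h i)) lo len)
  (PS.+-cong (PS.refl {Sum g lo len}) (PS.sym (Sum-neg h lo len)))

sumBelow : ℕ → (ℕ → ℤ) → ℤ
sumBelow zero    f = + 0
sumBelow (suc n) f = sumBelow n f + f n

sumBelow-suc : ∀ n f → sumBelow (suc n) f ≡ sumTo n f
sumBelow-suc zero    f = ℤP.+-identityˡ (f 0)
sumBelow-suc (suc n) f = cong (_+ f (suc n)) (sumBelow-suc n f)

Sum-coefficient : ∀ g lo len k → Sum g lo len k ≡ sumBelow len (λ i → g (lo ℕ.+ i) k)
Sum-coefficient g lo zero      k = refl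
Sum-coefficient g lo (suc len) k =
  trans (Sum-snoc g lo len k) (cong (_+ g (lo ℕ.+ len) k) (Sum-coefficient g lo len k))

sumBelow-cong : ∀ n {f g : ℕ → ℤ} → (∀ i → i < n → f i ≡ g i) → sumBelow n f ≡ sumBelow n g
sumBelow-cong zero    e = refl
sumBelow-cong (suc n) e = cong₂ _+_ (sumBelow-cong n (λ i i<n → e i (ℕP.m<n⇒m<1+n i<n))) (e n ℕP.≤-refl)

sumBelow-extend : ∀ A k (f : ℕ → ℤ) → (∀ i → A ≤ i → f i ≡ + 0) → sumBelow (A ℕ.+ k) f ≡ sumBelow A f
sumBelow-extend A zero    f e = cong (λ m → sumBelow m f) (ℕP.+-identityʳ A)
sumBelow-extend A (suc k) f e = trans (cong (λ m → sumBelow m f) (ℕP.+-suc A k))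
  (trans (cong₂ _+_ (sumBelow-extend A k f e) (e (A ℕ.+ k) (ℕP.m≤m+n A k))) (ℤP.+-identityʳ _))

-- The Θ₀-identity modulo q^(M+1)

factor : PS → ℕ → PS
factor y i = one ⊖ y ⊛ q^ i

qFactor : ℕ → PS
qFactor i = one ⊖ q^ i

C2-suc : ∀ n → suc n C 2 ≡ n ℕ.+ n C 2
C2-suc n = trans (sym (nCk+nC[k+1]≡[n+1]C[k+1] n 1)) (cong (ℕ._+ n C 2) (nC1≡n n))

module Truncated (M : ℕ) where

  N : ℕ
  N = suc M

  infix 4 _≈_
  _≈_ : PS → PS → Set
  f ≈ g = f ≈[ N ] g

  module ≈-Reasoning = SetoidReasoning (≈-setoid N)

  -- Modulo q^N, Prod (factor y) p N is the q-Pochhammer symbol (y q^p; q)_∞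
  -- and qPoch p is (q^(p+1); q)_∞.
  yPoch : PS → ℕ → PS
  yPoch y p = Prod (factor y) p N

  qPoch : ℕ → PS
  qPoch p = Prod qFactor (suc p) N

  W-term : PS → ℕ → PS
  W-term y p = q^ p ⊛ (yPoch y p ⊛ qPoch p)

  W : PS → PS
  W y = Sum (W-term y) 0 N

  Θ-term : PS → ℕ → PS
  Θ-term y n = q^ (n C 2) ⊛ powPS (negPS y) n

  T : PS → PS
  T y = Sum (Θ-term y) 0 (suc N)

  factor-≈one : ∀ y i → N ≤ i → factor y i ≈ one
  factor-≈one y i N≤i = ≈-trans
    (⊕-cong-≈ (≈-refl one) (neg-cong-≈ (≈-trans (≗⇒≈ (⊛-comm y (q^ i))) (q^⊛≈𝟘 i y N≤i))))
    (≗⇒≈ (PS.+-identityʳ one))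

  qFactor-≈one : ∀ i → N ≤ i → qFactor i ≈ one
  qFactor-≈one i N≤i = ≈-trans
    (⊕-cong-≈ (≈-refl one) (neg-cong-≈ (≈-trans (≗⇒≈ (PS.sym (PS.*-identityʳ (q^ i)))) (q^⊛≈𝟘 i one N≤i))))
    (≗⇒≈ (PS.+-identityʳ one))

  Prod-slide : ∀ f lo → (∀ i → N ≤ i → f i ≈ one) → Prod f lo N ≈ f lo ⊛ Prod f (suc lo) N
  Prod-slide f lo big = ⊛-cong-≈ (≈-refl (f lo)) (≈-sym (≈-trans (≗⇒≈ (Prod-snoc f (suc lo) M))
    (≈-trans (⊛-cong-≈ (≈-refl (Prod f (suc lo) M)) (big (suc lo ℕ.+ M) (s≤s (ℕP.m≤n+m M lo))))
      (≗⇒≈ (PS.*-identityʳ (Prod f (suc lo) M))))))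

  Prod-extend : ∀ f lo n k → (∀ i → N ≤ i → f i ≈ one) → N ≤ lo ℕ.+ n → Prod f lo (n ℕ.+ k) ≈ Prod f lo n
  Prod-extend f lo n k big N≤ = ≈-trans (≗⇒≈ (Prod-split f lo n k))
    (≈-trans (⊛-cong-≈ (≈-refl (Prod f lo n)) (Prod-≈one f (lo ℕ.+ n) k (λ i le → big i (ℕP.≤-trans N≤ le))))
      (≗⇒≈ (PS.*-identityʳ (Prod f lo n))))

  yPoch-slide : ∀ y p → yPoch y p ≈ factor y p ⊛ yPoch y (suc p)
  yPoch-slide y p = Prod-slide (factor y) p (factor-≈one y)

  qPoch-slide : ∀ p → qPoch p ≈ qFactor (suc p) ⊛ qPoch (suc p)
  qPoch-slide p = Prod-slide qFactor (suc p) qFactor-≈one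

  yPoch-⊛q : ∀ y p → yPoch (y ⊛ q) p ≈ yPoch y (suc p)
  yPoch-⊛q y p = ≈-trans
    (Prod-cong-≈ (factor (y ⊛ q)) (factor y ∘ suc) p N
      (λ i _ → ≗⇒≈ (PS.+-cong (PS.refl {one}) (PS.-‿cong (PS.*-assoc y q (q^ i))))))
    (≗⇒≈ (PS.sym (Prod-suc (factor y) p N)))

  factor-cong : ∀ {y y′} i → y ≈ y′ → factor y i ≈ factor y′ i
  factor-cong i e = ⊕-cong-≈ (≈-refl one) (neg-cong-≈ (⊛-cong-≈ e (≈-refl (q^ i))))

  W-cong : ∀ {y y′} → y ≈ y′ → W y ≈ W y′
  W-cong {y} {y′} e = Sum-cong-≈ (W-term y) (W-term y′) 0 N (λ p _ → ⊛-cong-≈ (≈-refl (q^ p))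
    (⊛-cong-≈ (Prod-cong-≈ (factor y) (factor y′) p N (λ i _ → factor-cong i e)) (≈-refl (qPoch p))))

  T-cong : ∀ {y y′} → y ≈ y′ → T y ≈ T y′
  T-cong {y} {y′} e = Sum-cong-≈ (Θ-term y) (Θ-term y′) 0 (suc N)
    (λ n _ → ⊛-cong-≈ (≈-refl (q^ (n C 2))) (pow-cong-≈ n (neg-cong-≈ e)))

  -- W and T satisfy the same q-difference equation F(y) = (1 − y) F(yq) + yq F(yq²).
  module W-difference (y : PS) where
    y₁ y₂ : PS
    y₁ = y ⊛ q
    y₂ = y₁ ⊛ q

    V U : ℕ → PS
    V p = (q^ p ⊛ yPoch y₁ p) ⊛ (q^ p ⊛ qPoch p)
    U p = (q^ p ⊛ yPoch y₁ p) ⊛ qPoch (p ∸ 1)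

    W-term-split : ∀ p → W-term y p ≈ W-term y₁ p ⊖ y ⊛ V p
    W-term-split p = ≈-trans
      (⊛-cong-≈ (≈-refl (q^ p)) (⊛-cong-≈
        (≈-trans (yPoch-slide y p) (⊛-cong-≈ (≈-refl (factor y p)) (≈-sym (yPoch-⊛q y p))))
        (≈-refl (qPoch p))))
      (≗⇒≈ (solve 4 (λ P A B Y → P :* (((con (+ 1) :- Y :* P) :* A) :* B)
                               := P :* (A :* B) :- Y :* ((P :* A) :* (P :* B)))
              (λ _ → refl) (q^ p) (yPoch y₁ p) (qPoch p) y))

    V-suc : ∀ p → V (suc p) ≈ W-term y₁ (suc p) ⊖ U (suc p)
    V-suc p = ≈-trans
      (≗⇒≈ (solve 3 (λ P A B → (P :* A) :* (P :* B) := P :* (A :* B) :- (P :* A) :* ((con (+ 1) :- P) :* B))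
              (λ _ → refl) (q^ (suc p)) (yPoch y₁ (suc p)) (qPoch (suc p))))
      (⊕-cong-≈ (≈-refl (W-term y₁ (suc p)))
        (neg-cong-≈ (⊛-cong-≈ (≈-refl (q^ (suc p) ⊛ yPoch y₁ (suc p))) (≈-sym (qPoch-slide p)))))

    U-suc : ∀ p → U (suc p) ≈ q ⊛ W-term y₂ p
    U-suc p = ≈-trans
      (⊛-cong-≈ (⊛-cong-≈ (≈-refl (q^ (suc p))) (≈-sym (yPoch-⊛q y₁ p))) (≈-refl (qPoch p)))
      (≗⇒≈ (solve 4 (λ Q P A B → ((Q :* P) :* A) :* B := Q :* (P :* (A :* B)))
              (λ _ → refl) q (q^ p) (yPoch y₂ p) (qPoch p)))

    Sum-U : Sum U 1 M ≈ q ⊛ W y₂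
    Sum-U = begin
        Sum U 1 M
      ≈⟨ Sum-cong-≈ U (λ p → q ⊛ W-term y₂ (p ∸ 1)) 1 M (λ { (suc p) _ → U-suc p }) ⟩
        Sum (λ p → q ⊛ W-term y₂ (p ∸ 1)) 1 M
      ≈⟨ ≗⇒≈ (PS.trans (Sum-suc _ 0 M) (PS.sym (Sum-⊛ˡ q (W-term y₂) 0 M))) ⟩
        q ⊛ Sum (W-term y₂) 0 M
      ≈⟨ ≈-sym (≗⇒≈ (PS.+-identityʳ _)) ⟩
        q ⊛ Sum (W-term y₂) 0 M ⊕ 𝟘
      ≈⟨ ⊕-cong-≈ (≈-refl (q ⊛ Sum (W-term y₂) 0 M)) (≈-sym (≈-trans
           (≗⇒≈ (PS.sym (PS.*-assoc q (q^ M) (yPoch y₂ M ⊛ qPoch M))))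
           (q^⊛≈𝟘 N (yPoch y₂ M ⊛ qPoch M) ℕP.≤-refl))) ⟩
        q ⊛ Sum (W-term y₂) 0 M ⊕ q ⊛ W-term y₂ M
      ≈⟨ ≗⇒≈ (PS.sym (PS.trans (PS.*-cong (PS.refl {q}) (Sum-snoc (W-term y₂) 0 M))
                                (PS.distribˡ q (Sum (W-term y₂) 0 M) (W-term y₂ M)))) ⟩
        q ⊛ W y₂
      ∎
      where open ≈-Reasoning

    Sum-V : Sum V 0 N ≈ W y₁ ⊖ q ⊛ W y₂
    Sum-V = begin
        V 0 ⊕ Sum V 1 M
      ≈⟨ ⊕-cong-≈ (≗⇒≈ (solve 2 (λ A B → (con (+ 1) :* A) :* (con (+ 1) :* B) := con (+ 1) :* (A :* B))
                           (λ _ → refl) (yPoch y₁ 0) (qPoch 0)))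
                  (Sum-cong-≈ V (λ p → W-term y₁ p ⊖ U p) 1 M (λ { (suc p) _ → V-suc p })) ⟩
        W-term y₁ 0 ⊕ Sum (λ p → W-term y₁ p ⊖ U p) 1 M
      ≈⟨ ≗⇒≈ (PS.trans (PS.+-cong (PS.refl {W-term y₁ 0}) (Sum-⊖ (W-term y₁) U 1 M))
                        (PS.sym (PS.+-assoc (W-term y₁ 0) _ _))) ⟩
        W y₁ ⊖ Sum U 1 M
      ≈⟨ ⊕-cong-≈ (≈-refl (W y₁)) (neg-cong-≈ Sum-U) ⟩
        W y₁ ⊖ q ⊛ W y₂
      ∎
      where open ≈-Reasoning

    equation : W y ≈ (one ⊖ y) ⊛ W y₁ ⊕ y₁ ⊛ W y₂
    equation = begin
        W y
      ≈⟨ Sum-cong-≈ (W-term y) (λ p → W-term y₁ p ⊖ y ⊛ V p) 0 N (λ p _ → W-term-split p) ⟩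
        Sum (λ p → W-term y₁ p ⊖ y ⊛ V p) 0 N
      ≈⟨ ≗⇒≈ (PS.trans (Sum-⊖ (W-term y₁) (λ p → y ⊛ V p) 0 N)
                        (PS.+-cong (PS.refl {W y₁}) (PS.-‿cong (PS.sym (Sum-⊛ˡ y V 0 N))))) ⟩
        W y₁ ⊖ y ⊛ Sum V 0 N
      ≈⟨ ⊕-cong-≈ (≈-refl (W y₁)) (neg-cong-≈ (⊛-cong-≈ (≈-refl y) Sum-V)) ⟩
        W y₁ ⊖ y ⊛ (W y₁ ⊖ q ⊛ W y₂)
      ≈⟨ ≗⇒≈ (solve 4 (λ W₁ W₂ Y Q → W₁ :- Y :* (W₁ :- Q :* W₂) := (con (+ 1) :- Y) :* W₁ :+ (Y :* Q) :* W₂)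
                (λ _ → refl) (W y₁) (W y₂) y q) ⟩
        (one ⊖ y) ⊛ W y₁ ⊕ y₁ ⊛ W y₂
      ∎
      where open ≈-Reasoning

  pow-neg-⊛q : ∀ y n → powPS (negPS (y ⊛ q)) n ≗ powPS (negPS y) n ⊛ q^ n
  pow-neg-⊛q y zero    = PS.sym (PS.*-identityˡ one)
  pow-neg-⊛q y (suc n) = PS.trans (PS.*-cong (PS.refl {negPS (y ⊛ q)}) (pow-neg-⊛q y n))
    (solve 4 (λ Y Q P R → (:- (Y :* Q)) :* (P :* R) := ((:- Y) :* P) :* (Q :* R)) (λ _ → refl)
      y q (powPS (negPS y) n) (q^ n))

  Θ-term-suc : ∀ y n → Θ-term y (suc n) ≈ negPS y ⊛ Θ-term (y ⊛ q) n
  Θ-term-suc y n = ≗⇒≈ (begin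
      q^ (suc n C 2) ⊛ (negPS y ⊛ powPS (negPS y) n)
    ≈⟨ PS.*-cong (λ k → cong (λ m → (q^ m) k) (C2-suc n)) (PS.refl {negPS y ⊛ powPS (negPS y) n}) ⟩
      q^ (n ℕ.+ n C 2) ⊛ (negPS y ⊛ powPS (negPS y) n)
    ≈⟨ PS.*-cong (q^-+ n (n C 2)) (PS.refl {negPS y ⊛ powPS (negPS y) n}) ⟩
      (q^ n ⊛ q^ (n C 2)) ⊛ (negPS y ⊛ powPS (negPS y) n)
    ≈⟨ solve 4 (λ Qn Qc Y P → (Qn :* Qc) :* (Y :* P) := Y :* (Qc :* (P :* Qn)))
         (λ _ → refl) (q^ n) (q^ (n C 2)) (negPS y) (powPS (negPS y) n) ⟩
      negPS y ⊛ (q^ (n C 2) ⊛ (powPS (negPS y) n ⊛ q^ n))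
    ≈⟨ PS.*-cong (PS.refl {negPS y}) (PS.*-cong (PS.refl {q^ (n C 2)}) (PS.sym (pow-neg-⊛q y n))) ⟩
      negPS y ⊛ Θ-term (y ⊛ q) n
    ∎)
    where
    open SetoidReasoning PS.setoid

  Θ-term-last : ∀ y → Θ-term (y ⊛ q) N ≈ 𝟘
  Θ-term-last y = ≈-trans
    (≗⇒≈ (PS.trans (PS.*-cong (PS.refl {q^ (N C 2)}) (pow-neg-⊛q y N))
      (solve 3 (λ Qc P Qn → Qc :* (P :* Qn) := Qn :* (Qc :* P)) (λ _ → refl)
        (q^ (N C 2)) (powPS (negPS y) N) (q^ N))))
    (q^⊛≈𝟘 N (q^ (N C 2) ⊛ powPS (negPS y) N) ℕP.≤-refl)

  T-recursion : ∀ y → T y ≈ one ⊖ y ⊛ T (y ⊛ q)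
  T-recursion y = begin
      Θ-term y 0 ⊕ Sum (Θ-term y) 1 N
    ≈⟨ ≗⇒≈ (PS.+-cong (PS.*-identityˡ one) (Sum-suc (Θ-term y) 0 N)) ⟩
      one ⊕ Sum (Θ-term y ∘ suc) 0 N
    ≈⟨ ⊕-cong-≈ (≈-refl one) (Sum-cong-≈ (Θ-term y ∘ suc) (λ n → negPS y ⊛ Θ-term (y ⊛ q) n) 0 N
                                            (λ n _ → Θ-term-suc y n)) ⟩
      one ⊕ Sum (λ n → negPS y ⊛ Θ-term (y ⊛ q) n) 0 N
    ≈⟨ ≗⇒≈ (PS.+-cong (PS.refl {one}) (PS.sym (Sum-⊛ˡ (negPS y) (Θ-term (y ⊛ q)) 0 N))) ⟩
      one ⊕ negPS y ⊛ Sum (Θ-term (y ⊛ q)) 0 N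
    ≈⟨ ⊕-cong-≈ (≈-refl one) (⊛-cong-≈ (≈-refl (negPS y)) (≈-sym (≈-trans
         (≗⇒≈ (Sum-snoc (Θ-term (y ⊛ q)) 0 N))
         (≈-trans (⊕-cong-≈ (≈-refl (Sum (Θ-term (y ⊛ q)) 0 N)) (Θ-term-last y))
                  (≗⇒≈ (PS.+-identityʳ (Sum (Θ-term (y ⊛ q)) 0 N))))))) ⟩
      one ⊕ negPS y ⊛ T (y ⊛ q)
    ≈⟨ ≗⇒≈ (solve 2 (λ Y S → con (+ 1) :+ (:- Y) :* S := con (+ 1) :- Y :* S) (λ _ → refl) y (T (y ⊛ q))) ⟩
      one ⊖ y ⊛ T (y ⊛ q)
    ∎
    where open ≈-Reasoning

  T-difference-equation : ∀ y → T y ≈ (one ⊖ y) ⊛ T (y ⊛ q) ⊕ (y ⊛ q) ⊛ T ((y ⊛ q) ⊛ q)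
  T-difference-equation y = begin
      T y
    ≈⟨ T-recursion y ⟩
      one ⊖ y ⊛ T₁
    ≈⟨ ≗⇒≈ (solve 2 (λ Y T₁ → con (+ 1) :- Y :* T₁ := (con (+ 1) :- Y) :* T₁ :+ (con (+ 1) :- T₁))
              (λ _ → refl) y T₁) ⟩
      (one ⊖ y) ⊛ T₁ ⊕ (one ⊖ T₁)
    ≈⟨ ⊕-cong-≈ (≈-refl ((one ⊖ y) ⊛ T₁)) (⊕-cong-≈ (≈-refl one) (neg-cong-≈ (T-recursion (y ⊛ q)))) ⟩
      (one ⊖ y) ⊛ T₁ ⊕ (one ⊖ (one ⊖ (y ⊛ q) ⊛ T₂))
    ≈⟨ ≗⇒≈ (solve 3 (λ Y T₁ Z → (con (+ 1) :- Y) :* T₁ :+ (con (+ 1) :- (con (+ 1) :- Z))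
                               := (con (+ 1) :- Y) :* T₁ :+ Z) (λ _ → refl) y T₁ ((y ⊛ q) ⊛ T₂)) ⟩
      (one ⊖ y) ⊛ T₁ ⊕ (y ⊛ q) ⊛ T₂
    ∎
    where
    open ≈-Reasoning
    T₁ T₂ : PS
    T₁ = T (y ⊛ q)
    T₂ = T ((y ⊛ q) ⊛ q)

  Δ : PS → PS
  Δ y = W y ⊖ T y

  Δ-difference-equation : ∀ y → Δ y ≈ (one ⊖ y) ⊛ Δ (y ⊛ q) ⊕ (y ⊛ q) ⊛ Δ ((y ⊛ q) ⊛ q)
  Δ-difference-equation y = ≈-trans
    (⊕-cong-≈ (W-difference.equation y) (neg-cong-≈ (T-difference-equation y)))
    (≗⇒≈ (solve 6 (λ W₁ W₂ T₁ T₂ Y Q → ((con (+ 1) :- Y) :* W₁ :+ (Y :* Q) :* W₂)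
                                        :- ((con (+ 1) :- Y) :* T₁ :+ (Y :* Q) :* T₂)
                                      := (con (+ 1) :- Y) :* (W₁ :- T₁) :+ (Y :* Q) :* (W₂ :- T₂))
            (λ _ → refl) (W (y ⊛ q)) (W ((y ⊛ q) ⊛ q)) (T (y ⊛ q)) (T ((y ⊛ q) ⊛ q)) y q))

  Δ-cong : ∀ {y y′} → y ≈ y′ → Δ y ≈ Δ y′
  Δ-cong e = ⊕-cong-≈ (W-cong e) (neg-cong-≈ (T-cong e))

  qPoch-telescope : ∀ n → Sum (λ p → q^ p ⊛ qPoch p) 0 (suc n) ≈ qPoch n
  qPoch-telescope zero    = ≗⇒≈ (PS.trans (PS.+-identityʳ _) (PS.*-identityˡ (qPoch 0)))
  qPoch-telescope (suc n) = ≈-trans (≗⇒≈ (Sum-snoc (λ p → q^ p ⊛ qPoch p) 0 (suc n)))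
    (≈-trans (⊕-cong-≈ (≈-trans (qPoch-telescope n) (qPoch-slide n)) (≈-refl (q^ (suc n) ⊛ qPoch (suc n))))
      (≗⇒≈ (solve 2 (λ P B → (con (+ 1) :- P) :* B :+ P :* B := B) (λ _ → refl) (q^ (suc n)) (qPoch (suc n)))))

  W-𝟘 : W 𝟘 ≈ one
  W-𝟘 = ≈-trans
    (Sum-cong-≈ (W-term 𝟘) (λ p → q^ p ⊛ qPoch p) 0 N (λ p _ → ⊛-cong-≈ (≈-refl (q^ p))
      (≈-trans (⊛-cong-≈ (Prod-≈one (factor 𝟘) p N (λ i _ → factor-𝟘 i)) (≈-refl (qPoch p)))
               (≗⇒≈ (PS.*-identityˡ (qPoch p))))))
    (≈-trans (qPoch-telescope M) (Prod-≈one qFactor N N (λ i N≤i → qFactor-≈one i N≤i)))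
    where
    factor-𝟘 : ∀ i → factor 𝟘 i ≈ one
    factor-𝟘 i = ≗⇒≈ (PS.trans (PS.+-cong (PS.refl {one}) (PS.-‿cong (PS.zeroˡ (q^ i)))) (PS.+-identityʳ one))

  T-𝟘 : T 𝟘 ≈ one
  T-𝟘 = ≈-trans
    (⊕-cong-≈ (≗⇒≈ (PS.*-identityˡ one)) (Sum-≈𝟘 (Θ-term 𝟘) 1 N (λ { (suc n) _ → ≗⇒≈ (Θ-term-𝟘 n) })))
    (≗⇒≈ (PS.+-identityʳ one))
    where
    Θ-term-𝟘 : ∀ n → Θ-term 𝟘 (suc n) ≗ 𝟘
    Θ-term-𝟘 n = PS.trans (PS.*-cong (PS.refl {q^ (suc n C 2)}) (PS.zeroˡ (powPS (negPS 𝟘) n)))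
                          (PS.zeroʳ (q^ (suc n C 2)))

  -- Iterating the difference equation N times only involves Δ (y q^j) with j ≥ N,
  -- and y q^j ≈ 𝟘 there.
  Δ≈𝟘 : ∀ y → Δ y ≈ 𝟘
  Δ≈𝟘 y = vanish N 0 ℕP.≤-refl
    where
    y⊛q^ : ℕ → PS
    y⊛q^ zero    = y
    y⊛q^ (suc j) = y⊛q^ j ⊛ q

    y⊛q^≗ : ∀ j → y⊛q^ j ≗ q^ j ⊛ y
    y⊛q^≗ zero    = PS.sym (PS.*-identityˡ y)
    y⊛q^≗ (suc j) = PS.trans (PS.*-cong (y⊛q^≗ j) (PS.refl {q}))
      (solve 3 (λ P Y Q → (P :* Y) :* Q := (Q :* P) :* Y) (λ _ → refl) (q^ j) y q)

    vanish : ∀ k j → N ≤ j ℕ.+ k → Δ (y⊛q^ j) ≈ 𝟘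
    vanish zero    j N≤ = ≈-trans
      (Δ-cong (≈-trans (≗⇒≈ (y⊛q^≗ j)) (q^⊛≈𝟘 j y (subst (N ≤_) (ℕP.+-identityʳ j) N≤))))
      (≈-trans (⊕-cong-≈ W-𝟘 (neg-cong-≈ T-𝟘)) (≗⇒≈ (PS.-‿inverseʳ one)))
    vanish (suc k) j N≤ = ≈-trans (Δ-difference-equation (y⊛q^ j))
      (≈-trans (⊕-cong-≈ (⊛-cong-≈ (≈-refl (one ⊖ y⊛q^ j)) (vanish k (suc j) N≤′))
                         (⊛-cong-≈ (≈-refl (y⊛q^ (suc j))) (vanish k (suc (suc j)) (ℕP.≤-trans N≤′ (ℕP.n≤1+n _)))))
        (≗⇒≈ (solve 2 (λ A B → A :* con (+ 0) :+ B :* con (+ 0) := con (+ 0)) (λ _ → refl)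
                (one ⊖ y⊛q^ j) (y⊛q^ (suc j)))))
      where
      N≤′ : N ≤ suc j ℕ.+ k
      N≤′ = subst (N ≤_) (ℕP.+-suc j k) N≤

  W≈T : ∀ y → W y ≈ T y
  W≈T y = ≈-trans
    (≗⇒≈ (solve 2 (λ W T → W := T :+ (W :- T)) (λ _ → refl) (W y) (T y)))
    (≈-trans (⊕-cong-≈ (≈-refl (T y)) (Δ≈𝟘 y)) (≗⇒≈ (PS.+-identityʳ (T y))))

  -- If t = 1 + Σ_{p≥1} q^p L_p R_p with L_{p+1} = 1/∏_{i=1}^{p}(1 − t q^i) and
  -- R_p = 1/∏_{i=1}^{p}(1 − q^i), then multiplying by Q = (tq; q)_∞ (q; q)_∞
  -- turns t Q − Q into the tail Σ_{p≥1} of W t, while its p = 0 term is (1 − t) Q.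
  W≈𝟘 : ∀ t (L R : ℕ → PS) →
        t ≈ one ⊕ Sum (λ p → q^ p ⊛ (L p ⊛ R p)) 1 M →
        (∀ p → L (suc p) ⊛ Prod (factor t) 1 p ≗ one) →
        (∀ p → R p ⊛ Prod qFactor 1 p ≗ one) →
        W t ≈ 𝟘
  W≈𝟘 t L R t-eq L-inv R-inv = begin
      W-term t 0 ⊕ tail
    ≈⟨ ⊕-cong-≈ (⊛-cong-≈ (≈-refl one) (⊛-cong-≈ (yPoch-slide t 0) (≈-refl (qPoch 0)))) (≈-refl tail) ⟩
      one ⊛ ((factor t 0 ⊛ yPoch t 1) ⊛ qPoch 0) ⊕ tail
    ≈⟨ ≗⇒≈ (solve 4 (λ T A B S → con (+ 1) :* (((con (+ 1) :- T :* con (+ 1)) :* A) :* B) :+ S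
                                := S :- (T :* (A :* B) :- A :* B))
              (λ _ → refl) t (yPoch t 1) (qPoch 0) tail) ⟩
      tail ⊖ (t ⊛ Q ⊖ Q)
    ≈⟨ ⊕-cong-≈ (≈-refl tail) (neg-cong-≈ (⊕-cong-≈ t⊛Q (≈-refl (negPS Q)))) ⟩
      tail ⊖ ((Q ⊕ tail) ⊖ Q)
    ≈⟨ ≗⇒≈ (solve 2 (λ Q S → S :- ((Q :+ S) :- Q) := con (+ 0)) (λ _ → refl) Q tail) ⟩
      𝟘
    ∎
    where
    open ≈-Reasoning
    tail Q : PS
    tail = Sum (W-term t) 1 M
    Q    = yPoch t 1 ⊛ qPoch 0

    Prod-window-split : ∀ f → (∀ i → N ≤ i → f i ≈ one) → ∀ p → Prod f 1 N ≈ Prod f 1 p ⊛ Prod f (suc p) N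
    Prod-window-split f big p = ≈-trans (≈-sym (Prod-extend f 1 N p big (ℕP.n≤1+n N)))
      (≈-trans (≗⇒≈ (λ k → cong (λ m → Prod f 1 m k) (ℕP.+-comm N p))) (≗⇒≈ (Prod-split f 1 p N)))

    LR⊛Q : ∀ p → (L (suc p) ⊛ R (suc p)) ⊛ Q ≈ yPoch t (suc p) ⊛ qPoch (suc p)
    LR⊛Q p = ≈-trans
      (⊛-cong-≈ (≈-refl (L (suc p) ⊛ R (suc p)))
        (⊛-cong-≈ (Prod-window-split (factor t) (factor-≈one t) p) (Prod-window-split qFactor qFactor-≈one (suc p))))
      (≗⇒≈ (PS.trans
        (solve 6 (λ L R E F A B → (L :* R) :* ((E :* A) :* (F :* B)) := ((L :* E) :* (R :* F)) :* (A :* B))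
          (λ _ → refl) (L (suc p)) (R (suc p)) (Prod (factor t) 1 p) (Prod qFactor 1 (suc p))
          (yPoch t (suc p)) (qPoch (suc p)))
        (PS.trans (PS.*-cong (PS.*-cong (L-inv p) (R-inv (suc p))) (PS.refl {yPoch t (suc p) ⊛ qPoch (suc p)}))
                  (PS.trans (PS.*-cong (PS.*-identityˡ one) (PS.refl {yPoch t (suc p) ⊛ qPoch (suc p)}))
                            (PS.*-identityˡ _)))))

    t⊛Q : t ⊛ Q ≈ Q ⊕ tail
    t⊛Q = ≈-trans (⊛-cong-≈ t-eq (≈-refl Q)) (≈-trans
      (≗⇒≈ (PS.trans (PS.distribʳ Q one _) (PS.+-cong (PS.*-identityˡ Q)
             (Sum-⊛ʳ (λ p → q^ p ⊛ (L p ⊛ R p)) 1 M Q))))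
      (⊕-cong-≈ (≈-refl Q) (Sum-cong-≈ _ (W-term t) 1 M (λ { (suc p) _ → ≈-trans
        (≗⇒≈ (PS.*-assoc (q^ (suc p)) (L (suc p) ⊛ R (suc p)) Q))
        (⊛-cong-≈ (≈-refl (q^ (suc p))) (LR⊛Q p)) }))))

  T≡Θ₀ : ∀ y → T y M ≡ Θ₀ (negPS y) M
  T≡Θ₀ y = trans (trans (Sum-coefficient (Θ-term y) 0 (suc N) M) (sumBelow-suc N _))
    (sumTo-cong N (λ n _ → sym (shift≗q^⊛ (n C 2) (powPS (negPS y) n) M)))

  Θ₀-vanishes-at : ∀ t (L R : ℕ → PS) →
        t ≈ one ⊕ Sum (λ p → q^ p ⊛ (L p ⊛ R p)) 1 M →
        (∀ p → L (suc p) ⊛ Prod (factor t) 1 p ≗ one) →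
        (∀ p → R p ⊛ Prod qFactor 1 p ≗ one) →
        Θ₀ (negPS t) M ≡ + 0
  Θ₀-vanishes-at t L R t-eq L-inv R-inv =
    trans (sym (T≡Θ₀ t)) (≈-trans (≈-sym (W≈T t)) (W≈𝟘 t L R t-eq L-inv R-inv) M ℕP.≤-refl)

-- Finite types and weighted fibres

recompute-≤ : ∀ {m n} → .(m ≤ n) → m ≤ n
recompute-≤ {m} {n} = recompute (m ≤? n)

Finite : Set → Set
Finite X = Σ ℕ (λ n → Fin n ↔ X)

size : ∀ {X} → Finite X → ℕ
size = proj₁

size-unique : ∀ {X} (a b : Finite X) → size a ≡ size b
size-unique (m , f) (n , g) = ↔⇒≡ (↔-trans f (↔-sym g))

Finite-↔ : ∀ {X Y} → X ↔ Y → Finite X → Finite Y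
Finite-↔ e (n , f) = n , ↔-trans f e

Finite-empty : ∀ {X} → ¬ X → Finite X
Finite-empty ¬x = 0 , mk↔ₛ′ (λ ()) (λ x → ⊥-elim (¬x x)) (λ x → ⊥-elim (¬x x)) (λ ())

Finite-⊎ : ∀ {X Y} → Finite X → Finite Y → Finite (X ⊎ Y)
Finite-⊎ (m , f) (n , g) = m ℕ.+ n , ↔-trans FinP.+↔⊎ (f ⊎-cong g)

Finite-× : ∀ {X Y} → Finite X → Finite Y → Finite (X × Y)
Finite-× (m , f) (n , g) = m ℕ.* n , ↔-trans FinP.*↔× (f ×-cong g)

record Below (A : ℕ) (Q : ℕ → Set) : Set where
  constructor below
  field
    index   : ℕ
    .index< : index < A
    value   : Q index

Below-suc : ∀ A Q → Below (suc A) Q ↔ (Below A Q ⊎ Q A)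
Below-suc A Q = mk↔ₛ′ to from to-from from-to
  where
  to : Below (suc A) Q → Below A Q ⊎ Q A
  to (below p p< x) with p ℕ.≟ A
  ... | yes refl = inj₂ x
  ... | no p≢A   = inj₁ (below p (ℕP.≤∧≢⇒< (ℕP.≤-pred (recompute-≤ p<)) p≢A) x)
  from : Below A Q ⊎ Q A → Below (suc A) Q
  from (inj₁ (below p p< x)) = below p (ℕP.m<n⇒m<1+n p<) x
  from (inj₂ x)              = below A ℕP.≤-refl x
  to-from : ∀ y → to (from y) ≡ y
  to-from (inj₁ (below p p< x)) with p ℕ.≟ A
  ... | yes refl = ⊥-elim (ℕP.<-irrefl refl (recompute-≤ p<))
  ... | no _     = refl
  to-from (inj₂ x) with A ℕ.≟ A
  ... | yes refl = refl
  ... | no A≢A   = ⊥-elim (A≢A refl)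
  from-to : ∀ x → from (to x) ≡ x
  from-to (below p p< x) with p ℕ.≟ A
  ... | yes refl = refl
  ... | no _     = refl

Below-cong : ∀ {A F G} → (∀ m → F m ↔ G m) → Below A F ↔ Below A G
Below-cong e = mk↔ₛ′ (λ { (below p p< v) → below p p< (Inverse.to (e p) v) })
  (λ { (below p p< v) → below p p< (Inverse.from (e p) v) })
  (λ { (below p p< v) → cong (below p p<) (Inverse.strictlyInverseˡ (e p) v) })
  (λ { (below p p< v) → cong (below p p<) (Inverse.strictlyInverseʳ (e p) v) })

Finite-Below : ∀ A Q → (∀ p → p < A → Finite (Q p)) → Finite (Below A Q)
Finite-Below zero    Q fin = Finite-empty (λ { (below _ () _) })
Finite-Below (suc A) Q fin = Finite-↔ (↔-sym (Below-suc A Q))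
  (Finite-⊎ (Finite-Below A Q (λ p p<A → fin p (ℕP.m<n⇒m<1+n p<A))) (fin A ℕP.≤-refl))

size-Below : ∀ A Q fin (F : ℕ → ℤ) → (∀ p p<A → + size (fin p p<A) ≡ F p) →
             + size (Finite-Below A Q fin) ≡ sumBelow A F
size-Below zero    Q fin F e = refl
size-Below (suc A) Q fin F e = trans (ℤP.pos-+ (size (Finite-Below A Q _)) _)
  (cong₂ _+_ (size-Below A Q _ F (λ p p<A → e p (ℕP.m<n⇒m<1+n p<A))) (e A ℕP.≤-refl))

-- Shift k A F is F (A - k) when k ≤ A and empty otherwise: multiplication by q^k.
record Shift (k A : ℕ) (F : ℕ → Set) : Set where
  constructor shifted
  field
    .k≤A  : k ≤ A
    value : F (A ∸ k)

Shift-cong : ∀ {k A F G} → (∀ m → F m ↔ G m) → Shift k A F ↔ Shift k A G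
Shift-cong {k} {A} e = mk↔ₛ′ (λ { (shifted k≤A v) → shifted k≤A (Inverse.to (e (A ∸ k)) v) })
  (λ { (shifted k≤A v) → shifted k≤A (Inverse.from (e (A ∸ k)) v) })
  (λ { (shifted k≤A v) → cong (shifted k≤A) (Inverse.strictlyInverseˡ (e (A ∸ k)) v) })
  (λ { (shifted k≤A v) → cong (shifted k≤A) (Inverse.strictlyInverseʳ (e (A ∸ k)) v) })

Finite-Shift : ∀ k A F → (k ≤ A → Finite (F (A ∸ k))) → Finite (Shift k A F)
Finite-Shift k A F fin with k ≤? A
... | yes k≤A = Finite-↔ (mk↔ₛ′ (shifted k≤A) Shift.value (λ _ → refl) (λ _ → refl)) (fin k≤A)
... | no k≰A  = Finite-empty (λ { (shifted k≤A _) → k≰A (recompute-≤ k≤A) })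

size-Shift : ∀ k A F fin (s : ℕ → ℕ) → (∀ k≤A → size (fin k≤A) ≡ s (A ∸ k)) →
             + size (Finite-Shift k A F fin) ≡ shift k (λ m → + s m) A
size-Shift k A F fin s e with k ≤? A
... | yes k≤A = cong +_ (e k≤A)
... | no _    = refl

Fibre : (X : Set) → (X → ℕ) → ℕ → Set
Fibre X w A = Σ X (λ x → w x ≡ A)

fibre-≡ : ∀ {X : Set} {w : X → ℕ} {A} {x y : X} (e : w x ≡ A) (e′ : w y ≡ A) → x ≡ y → (x , e) ≡ (y , e′)
fibre-≡ e e′ refl = cong (_ ,_) (ℕP.≡-irrelevant e e′)

Fibre-↔ : ∀ {X Y : Set} {wx : X → ℕ} {wy : Y → ℕ} (f : X ↔ Y) → (∀ x → wy (Inverse.to f x) ≡ wx x) →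
          ∀ A → Fibre X wx A ↔ Fibre Y wy A
Fibre-↔ {wy = wy} f f-weight A = mk↔ₛ′
  (λ { (x , e) → Inverse.to f x , trans (f-weight x) e })
  (λ { (y , e) → Inverse.from f y , trans (sym (f-weight (Inverse.from f y))) (trans (cong wy (Inverse.strictlyInverseˡ f y)) e) })
  (λ { (y , e) → fibre-≡ _ e (Inverse.strictlyInverseˡ f y) })
  (λ { (x , e) → fibre-≡ _ e (Inverse.strictlyInverseʳ f x) })

Fibre-⊎ : ∀ {X Y : Set} (wx : X → ℕ) (wy : Y → ℕ) A →
          Fibre (X ⊎ Y) [ wx , wy ]′ A ↔ (Fibre X wx A ⊎ Fibre Y wy A)
Fibre-⊎ wx wy A = mk↔ₛ′ (λ { (inj₁ x , e) → inj₁ (x , e) ; (inj₂ y , e) → inj₂ (y , e) })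
  (λ { (inj₁ (x , e)) → inj₁ x , e ; (inj₂ (y , e)) → inj₂ y , e })
  (λ { (inj₁ (x , e)) → refl ; (inj₂ (y , e)) → refl })
  (λ { (inj₁ x , e) → refl ; (inj₂ y , e) → refl })

Fibre-shift : ∀ {X : Set} (w : X → ℕ) k A → Fibre X (λ x → k ℕ.+ w x) A ↔ Shift k A (Fibre X w)
Fibre-shift w k A = mk↔ₛ′
  (λ { (x , e) → shifted (subst (k ≤_) e (ℕP.m≤m+n k (w x))) (x , trans (sym (ℕP.m+n∸m≡n k (w x))) (cong (_∸ k) e)) })
  (λ { (shifted k≤A (x , e)) → x , trans (cong (k ℕ.+_) e) (ℕP.m+[n∸m]≡n (recompute-≤ k≤A)) })
  (λ { (shifted k≤A (x , e)) → cong (λ e′ → shifted k≤A (x , e′)) (ℕP.≡-irrelevant _ _) })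
  (λ { (x , e) → fibre-≡ _ e refl })

Convolution : (ℕ → Set) → (ℕ → Set) → ℕ → Set
Convolution F G m = Below (suc m) (λ j → F j × G (m ∸ j))

Fibre-× : ∀ {X Y : Set} (wx : X → ℕ) (wy : Y → ℕ) m →
          Fibre (X × Y) (λ (x , y) → wx x ℕ.+ wy y) m ↔ Convolution (Fibre X wx) (Fibre Y wy) m
Fibre-× wx wy m = mk↔ₛ′
  (λ { ((x , y) , e) → below (wx x) (s≤s (subst (wx x ≤_) e (ℕP.m≤m+n (wx x) (wy y))))
                         ((x , refl) , (y , trans (sym (ℕP.m+n∸m≡n (wx x) (wy y))) (cong (_∸ wx x) e))) })
  (λ { (below j j< ((x , ex) , (y , ey))) →
         (x , y) , trans (cong₂ ℕ._+_ ex ey) (ℕP.m+[n∸m]≡n (ℕP.≤-pred (recompute-≤ j<))) })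
  (λ { (below j j< ((x , refl) , (y , ey))) → cong (λ e′ → below (wx x) j< ((x , refl) , (y , e′))) (ℕP.≡-irrelevant _ _) })
  (λ { ((x , y) , e) → fibre-≡ _ e refl })

Point : ℕ → Set
Point = Fibre ⊤ (λ _ → 0)

Finite-Point : ∀ A → Finite (Point A)
Finite-Point zero    = 1 , mk↔ₛ′ (λ _ → tt , refl) (λ _ → Fin.zero) (λ { (tt , refl) → refl })
                                  (λ { Fin.zero → refl ; (Fin.suc ()) })
Finite-Point (suc A) = Finite-empty (λ { (tt , ()) })

-- Encoding trees

-- Partition hi: the weakly decreasing columns h₁ ≥ h₂ ≥ … ≥ 1 right of a peak of height hi.
data Partition : ℕ → Set where
  pnil  : ∀ {hi} → Partition hi
  pcons : ∀ {hi} (h : ℕ) → .(1 ≤ h) → .(h ≤ hi) → Partition h → Partition hi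

partitionArea : ∀ {hi} → Partition hi → ℕ
partitionArea pnil            = 0
partitionArea (pcons h _ _ r) = h ℕ.+ partitionArea r

-- Rise hi lo: the weakly increasing columns lo ≤ h₁ ≤ h₂ ≤ … < hi left of a peak of
-- height hi, each paired with the subtree hanging from it.
data Rise (hi : ℕ) : ℕ → Set where
  rnil  : ∀ {lo} → Rise hi lo
  rcons : ∀ {lo} (h : ℕ) → .(lo ≤ h) → .(h < hi) → Tree → Rise hi h → Rise hi lo

riseArea : ∀ {hi lo} → Rise hi lo → ℕ
riseArea rnil              = 0
riseArea (rcons h _ _ t r) = h ℕ.+ (area t ℕ.+ riseArea r)

Partition-zero : Partition 0 ↔ ⊤
Partition-zero = mk↔ₛ′ (λ _ → tt) (λ _ → pnil) (λ _ → refl)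
  (λ { pnil → refl ; (pcons h 1≤h h≤0 _) → ⊥-elim (ℕP.<-irrefl refl (ℕP.≤-trans (recompute-≤ 1≤h) (recompute-≤ h≤0))) })

-- Either no part equals h + 1, or removing the first part h + 1 leaves a partition.
Partition-split : ∀ h → Partition (suc h) ↔ (Partition h ⊎ Partition (suc h))
Partition-split h = mk↔ₛ′ to from to-from from-to
  where
  to : Partition (suc h) → Partition h ⊎ Partition (suc h)
  to pnil = inj₁ pnil
  to (pcons h′ 1≤h′ h′≤ r) with h′ ℕ.≟ suc h
  ... | yes refl = inj₂ r
  ... | no h′≢   = inj₁ (pcons h′ 1≤h′ (ℕP.≤-pred (ℕP.≤∧≢⇒< (recompute-≤ h′≤) h′≢)) r)
  from : Partition h ⊎ Partition (suc h) → Partition (suc h)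
  from (inj₁ pnil)                  = pnil
  from (inj₁ (pcons h′ 1≤h′ h′≤ r)) = pcons h′ 1≤h′ (ℕP.m≤n⇒m≤1+n (recompute-≤ h′≤)) r
  from (inj₂ r)                     = pcons (suc h) (s≤s z≤n) ℕP.≤-refl r
  to-from : ∀ y → to (from y) ≡ y
  to-from (inj₁ pnil) = refl
  to-from (inj₁ (pcons h′ _ h′≤ r)) with h′ ℕ.≟ suc h
  ... | yes refl = ⊥-elim (ℕP.<-irrefl refl (s≤s (recompute-≤ h′≤)))
  ... | no _     = refl
  to-from (inj₂ r) with suc h ℕ.≟ suc h
  ... | yes refl = refl
  ... | no h≢h   = ⊥-elim (h≢h refl)
  from-to : ∀ x → from (to x) ≡ x
  from-to pnil = refl
  from-to (pcons h′ _ _ r) with h′ ℕ.≟ suc h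
  ... | yes refl = refl
  ... | no _     = refl

Partition-split-area : ∀ h (x : Partition (suc h)) →
  [ partitionArea , (λ r → suc h ℕ.+ partitionArea r) ]′ (Inverse.to (Partition-split h) x) ≡ partitionArea x
Partition-split-area h pnil = refl
Partition-split-area h (pcons h′ _ _ r) with h′ ℕ.≟ suc h
... | yes refl = refl
... | no _     = refl

Rise-empty : ∀ hi lo → hi ≤ lo → Rise hi lo ↔ ⊤
Rise-empty hi lo hi≤lo = mk↔ₛ′ (λ _ → tt) (λ _ → rnil) (λ _ → refl)
  (λ { rnil → refl
     ; (rcons h lo≤h h<hi _ _) → ⊥-elim (ℕP.<-irrefl refl
         (ℕP.<-≤-trans (recompute-≤ h<hi) (ℕP.≤-trans hi≤lo (recompute-≤ lo≤h)))) })

-- Either no column has height lo, or the first column has height lo.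
Rise-split : ∀ hi lo → lo < hi → Rise hi lo ↔ (Rise hi (suc lo) ⊎ (Tree × Rise hi lo))
Rise-split hi lo lo<hi = mk↔ₛ′ to from to-from from-to
  where
  to : Rise hi lo → Rise hi (suc lo) ⊎ (Tree × Rise hi lo)
  to rnil = inj₁ rnil
  to (rcons h lo≤h h<hi t r) with lo ℕ.≟ h
  ... | yes refl = inj₂ (t , r)
  ... | no lo≢h  = inj₁ (rcons h (ℕP.≤∧≢⇒< (recompute-≤ lo≤h) lo≢h) h<hi t r)
  from : Rise hi (suc lo) ⊎ (Tree × Rise hi lo) → Rise hi lo
  from (inj₁ rnil)                     = rnil
  from (inj₁ (rcons h lo<h h<hi t r)) = rcons h (ℕP.<⇒≤ (recompute-≤ lo<h)) h<hi t r
  from (inj₂ (t , r))                  = rcons lo ℕP.≤-refl lo<hi t r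
  to-from : ∀ y → to (from y) ≡ y
  to-from (inj₁ rnil) = refl
  to-from (inj₁ (rcons h lo<h _ _ _)) with lo ℕ.≟ h
  ... | yes refl = ⊥-elim (ℕP.<-irrefl refl (recompute-≤ lo<h))
  ... | no _     = refl
  to-from (inj₂ (t , r)) with lo ℕ.≟ lo
  ... | yes refl = refl
  ... | no lo≢lo = ⊥-elim (lo≢lo refl)
  from-to : ∀ x → from (to x) ≡ x
  from-to rnil = refl
  from-to (rcons h _ _ _ _) with lo ℕ.≟ h
  ... | yes refl = refl
  ... | no _     = refl

Rise-split-area : ∀ hi lo lo<hi (x : Rise hi lo) →
  [ riseArea , (λ (t , r) → lo ℕ.+ (area t ℕ.+ riseArea r)) ]′ (Inverse.to (Rise-split hi lo lo<hi) x) ≡ riseArea x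
Rise-split-area hi lo lo<hi rnil = refl
Rise-split-area hi lo lo<hi (rcons h _ _ _ _) with lo ℕ.≟ h
... | yes refl = refl
... | no _     = refl


parts : ∀ {hi} → Partition hi → List ℕ
parts pnil            = []
parts (pcons h _ _ r) = h ∷ parts r

parts-positive : ∀ {hi} (d : Partition hi) → All (0 <_) (parts d)
parts-positive pnil              = []
parts-positive (pcons _ 1≤h _ r) = recompute-≤ 1≤h ∷ parts-positive r

parts-decreasing : ∀ {hi} (d : Partition hi) → Linked _≥_ (hi ∷ parts d)
parts-decreasing pnil              = [-]
parts-decreasing (pcons _ _ h≤ r) = recompute-≤ h≤ ∷ parts-decreasing r

fromParts : ∀ {hi hs} → All (0 <_) hs → Linked _≥_ (hi ∷ hs) → Partition hi
fromParts []           _          = pnil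
fromParts (0<h ∷ 0<hs) (h≤ ∷ dec) = pcons _ 0<h h≤ (fromParts 0<hs dec)

parts-fromParts : ∀ {hi hs} (pos : All (0 <_) hs) (dec : Linked _≥_ (hi ∷ hs)) → parts (fromParts pos dec) ≡ hs
parts-fromParts []           [-]       = refl
parts-fromParts (_ ∷ 0<hs) (_ ∷ dec) = cong (_ ∷_) (parts-fromParts 0<hs dec)

fromParts-parts : ∀ {hi} (d : Partition hi) pos dec → fromParts {hi} {parts d} pos dec ≡ d
fromParts-parts pnil            []         [-]       = refl
fromParts-parts (pcons h _ _ r) (_ ∷ 0<hs) (_ ∷ dec) = cong (pcons h _ _) (fromParts-parts r 0<hs dec)

sum-parts : ∀ {hi} (d : Partition hi) → sum (parts d) ≡ partitionArea d
sum-parts pnil            = refl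
sum-parts (pcons h _ _ r) = cong (h ℕ.+_) (sum-parts r)

riseLength : ∀ {hi lo} → Rise hi lo → ℕ
riseLength rnil              = 0
riseLength (rcons _ _ _ _ r) = suc (riseLength r)

subtrees : ∀ {hi lo} (r : Rise hi lo) → Vec Tree (riseLength r)
subtrees rnil              = []
subtrees (rcons _ _ _ t r) = t ∷ subtrees r

heights : ∀ {hi lo} → Rise hi lo → List ℕ → List ℕ
heights rnil              hs = hs
heights (rcons h _ _ _ r) hs = h ∷ heights r hs

heights-isStack : ∀ {p lo} (r : Rise (suc p) lo) (d : Partition (suc p)) →
                  IsStack (riseLength r) (heights r (suc p ∷ parts d))
heights-isStack rnil                                      d = peak (parts-decreasing d)
heights-isStack (rcons _ _ h<p _ rnil)                    d = rise1 (recompute-≤ h<p) (peak (parts-decreasing d))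
heights-isStack (rcons _ _ _ _ r@(rcons _ h≤h′ _ _ _)) d = riseS (recompute-≤ h≤h′) (heights-isStack r d)

heights-positive : ∀ {p lo} (r : Rise (suc p) lo) → 1 ≤ lo → (d : Partition (suc p)) →
                   All (0 <_) (heights r (suc p ∷ parts d))
heights-positive rnil                   1≤lo d = s≤s z≤n ∷ parts-positive d
heights-positive (rcons _ lo≤h _ _ r) 1≤lo d =
  1≤h ∷ heights-positive r 1≤h d where 1≤h = ℕP.≤-trans 1≤lo (recompute-≤ lo≤h)

-- (p , r , d) stands for the stack with peak p + 1, rise r and fall d.
StackCode : Set
StackCode = Σ ℕ (λ p → Rise (suc p) 1 × Partition (suc p))

stackCodeArea : StackCode → ℕ
stackCodeArea (p , r , d) = suc p ℕ.+ (riseArea r ℕ.+ partitionArea d)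

decode : StackCode → Tree
decode (p , r , d) =
  node (riseLength r) (stack (heights r (suc p ∷ parts d)) (heights-positive r ℕP.≤-refl d) (heights-isStack r d)) (subtrees r)

-- Encoding reads a stack from the left.  Suffix lo n f is the code of a suffix starting
-- with a column of height f ≥ lo and having n columns before its peak; the bound
-- relates f to the peak height (equal at the peak, smaller before it).
PeakBound : ℕ → ℕ → ℕ → Set
PeakBound zero    f hi = f ≤ hi
PeakBound (suc _) f hi = f < hi

record Suffix (lo n f : ℕ) : Set where
  constructor suffix
  field
    top     : ℕ
    rise    : Rise (suc top) lo
    fall    : Partition (suc top)
    .bound  : PeakBound n f (suc top)
open Suffix

head : List ℕ → ℕ
head []      = 0
head (h ∷ _) = h

Suffix-rise1 : ∀ {lo h f} → .(lo ≤ h) → .(h < f) → Tree → Suffix h 0 f → Suffix lo 1 h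
Suffix-rise1 {h = h} lo≤h h<f t (suffix p r d p≥f) =
  suffix p (rcons h lo≤h (ℕP.<-≤-trans h<f p≥f) t r) d (ℕP.<-≤-trans h<f p≥f)

Suffix-riseS : ∀ {lo h f j} → .(lo ≤ h) → .(h ≤ f) → Tree → Suffix h (suc j) f → Suffix lo (suc (suc j)) h
Suffix-riseS {h = h} lo≤h h≤f t (suffix p r d p>f) =
  suffix p (rcons h lo≤h (ℕP.≤-<-trans h≤f p>f) t r) d (ℕP.≤-<-trans h≤f p>f)

Suffix-peak : ∀ {h hs} lo → All (0 <_) (h ∷ hs) → Linked _≥_ (h ∷ hs) → Suffix lo 0 h
Suffix-peak lo (s≤s {n = p} z≤n ∷ 0<hs) dec = suffix p rnil (fromParts 0<hs dec) ℕP.≤-refl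

encodeSuffix : ∀ {n hs} lo → lo ≤ head hs → All (0 <_) hs → IsStack n hs → Vec Tree n → Suffix lo n (head hs)
encodeSuffix lo lo≤ pos       (peak dec)             []       = Suffix-peak lo pos dec
encodeSuffix lo lo≤ (_ ∷ pos) (rise1 {h} h<h′ st)    (t ∷ []) = Suffix-rise1 lo≤ h<h′ t (encodeSuffix h (ℕP.<⇒≤ h<h′) pos st [])
encodeSuffix lo lo≤ (_ ∷ pos) (riseS {_} {h} h≤h′ st) (t ∷ ts) = Suffix-riseS lo≤ h≤h′ t (encodeSuffix h h≤h′ pos st ts)

suffixCode : ∀ {lo n f} → Suffix lo n f → Σ ℕ (λ p → Rise (suc p) lo × Partition (suc p))
suffixCode s = top s , rise s , fall s

suffixCode-rise1 : ∀ {lo h f p} {r : Rise (suc p) h} {d : Partition (suc p)} .(lo≤h : lo ≤ h) .(h<f : h < f)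
  .(h<p : h < suc p) t (s : Suffix h 0 f) →
  suffixCode s ≡ (p , r , d) → suffixCode (Suffix-rise1 lo≤h h<f t s) ≡ (p , rcons h lo≤h h<p t r , d)
suffixCode-rise1 _ _ _ _ (suffix _ _ _ _) refl = refl

suffixCode-riseS : ∀ {lo h f j p} {r : Rise (suc p) h} {d : Partition (suc p)} .(lo≤h : lo ≤ h) .(h≤f : h ≤ f)
  .(h<p : h < suc p) t (s : Suffix h (suc j) f) →
  suffixCode s ≡ (p , r , d) → suffixCode (Suffix-riseS lo≤h h≤f t s) ≡ (p , rcons h lo≤h h<p t r , d)
suffixCode-riseS _ _ _ _ (suffix _ _ _ _) refl = refl

suffixCode-encode : ∀ {p lo} (r : Rise (suc p) lo) (d : Partition (suc p)) lo≤ pos →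
  suffixCode (encodeSuffix lo lo≤ pos (heights-isStack r d) (subtrees r)) ≡ (p , r , d)
suffixCode-encode rnil d lo≤ (s≤s z≤n ∷ 0<hs) = cong (λ d′ → _ , rnil , d′) (fromParts-parts d 0<hs (parts-decreasing d))
suffixCode-encode (rcons h lo≤h h<p t rnil) d lo≤ (_ ∷ pos) =
  suffixCode-rise1 lo≤ (recompute-≤ h<p) h<p t
    (encodeSuffix h (ℕP.<⇒≤ (recompute-≤ h<p)) pos (peak (parts-decreasing d)) []) (suffixCode-encode rnil d (ℕP.<⇒≤ (recompute-≤ h<p)) pos)
suffixCode-encode (rcons h lo≤h h<p t r@(rcons _ h≤h′ _ _ _)) d lo≤ (_ ∷ pos) =
  suffixCode-riseS lo≤ (recompute-≤ h≤h′) h<p t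
    (encodeSuffix h (recompute-≤ h≤h′) pos (heights-isStack r d) (subtrees r)) (suffixCode-encode r d (recompute-≤ h≤h′) pos)

NodeData : Set
NodeData = Σ ℕ (λ n → List ℕ × Vec Tree n)

consNode : ℕ → Tree → NodeData → NodeData
consNode h t (n , hs , ts) = suc n , h ∷ hs , t ∷ ts

suffixNode : ∀ {lo n f} → Suffix lo n f → NodeData
suffixNode s = riseLength (rise s) , heights (rise s) (suc (top s) ∷ parts (fall s)) , subtrees (rise s)

suffixNode-encode : ∀ {n hs} lo lo≤ pos (st : IsStack n hs) ts → suffixNode (encodeSuffix lo lo≤ pos st ts) ≡ (n , hs , ts)
suffixNode-encode lo lo≤ (s≤s z≤n ∷ 0<hs) (peak dec) [] = cong (λ hs → 0 , suc _ ∷ hs , []) (parts-fromParts 0<hs dec)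
suffixNode-encode lo lo≤ (_ ∷ pos) (rise1 {h} h<h′ st) (t ∷ []) =
  cong (consNode h t) (suffixNode-encode h (ℕP.<⇒≤ h<h′) pos st [])
suffixNode-encode lo lo≤ (_ ∷ pos) (riseS {_} {h} h≤h′ st) (t ∷ ts) =
  cong (consNode h t) (suffixNode-encode h h≤h′ pos st ts)

All-irrelevant : ∀ {hs} (p p′ : All (0 <_) hs) → p ≡ p′
All-irrelevant []       []         = refl
All-irrelevant (x ∷ xs) (x′ ∷ xs′) = cong₂ _∷_ (ℕP.≤-irrelevant x x′) (All-irrelevant xs xs′)

Linked-irrelevant : ∀ {hs} (p p′ : Linked _≥_ hs) → p ≡ p′
Linked-irrelevant []       []         = refl
Linked-irrelevant [-]      [-]        = refl
Linked-irrelevant (x ∷ xs) (x′ ∷ xs′) = cong₂ _∷_ (ℕP.≤-irrelevant x x′) (Linked-irrelevant xs xs′)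

IsStack-irrelevant : ∀ {n hs} (p p′ : IsStack n hs) → p ≡ p′
IsStack-irrelevant (peak l)     (peak l′)      = cong peak (Linked-irrelevant l l′)
IsStack-irrelevant (rise1 lt s) (rise1 lt′ s′) = cong₂ rise1 (ℕP.≤-irrelevant lt lt′) (IsStack-irrelevant s s′)
IsStack-irrelevant (riseS le s) (riseS le′ s′) = cong₂ riseS (ℕP.≤-irrelevant le le′) (IsStack-irrelevant s s′)

node-≡ : ∀ {n n′ hs hs′ ts ts′} → _≡_ {A = NodeData} (n , hs , ts) (n′ , hs′ , ts′) →
         ∀ pos pos′ st st′ → node n (stack hs pos st) ts ≡ node n′ (stack hs′ pos′ st′) ts′
node-≡ {n} {hs = hs} {ts = ts} refl pos pos′ st st′ =
  cong₂ (λ pos st → node n (stack hs pos st) ts) (All-irrelevant pos pos′) (IsStack-irrelevant st st′)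

head-positive : ∀ {n hs} → All (0 <_) hs → IsStack n hs → 1 ≤ head hs
head-positive (0<h ∷ _) _ = 0<h

encode : Tree → ⊤ ⊎ StackCode
encode (node _ emptyPoly [])           = inj₁ tt
encode (node n (stack hs pos st) ts) = inj₂ (suffixCode (encodeSuffix 1 (head-positive pos st) pos st ts))

Tree↔⊤⊎StackCode : Tree ↔ (⊤ ⊎ StackCode)
Tree↔⊤⊎StackCode = mk↔ₛ′ encode [ (λ _ → node 0 emptyPoly []) , decode ]′ encode-decode decode-encode
  where
  encode-decode : ∀ c → encode ([ (λ _ → node 0 emptyPoly []) , decode ]′ c) ≡ c
  encode-decode (inj₁ tt)          = refl
  encode-decode (inj₂ (p , r , d)) = cong inj₂ (suffixCode-encode r d _ _)
  decode-encode : ∀ t → [ (λ _ → node 0 emptyPoly []) , decode ]′ (encode t) ≡ t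
  decode-encode (node _ emptyPoly [])         = refl
  decode-encode (node n (stack hs pos st) ts) =
    node-≡ (suffixNode-encode 1 (head-positive pos st) pos st ts) _ pos _ st

area-heights : ∀ {hi lo} (r : Rise hi lo) hs → sum (heights r hs) ℕ.+ areas (subtrees r) ≡ riseArea r ℕ.+ sum hs
area-heights rnil              hs = ℕP.+-identityʳ (sum hs)
area-heights (rcons h _ _ t r) hs = begin
    (h ℕ.+ sum (heights r hs)) ℕ.+ (area t ℕ.+ areas (subtrees r))
  ≡⟨ ℕP.+-assoc h _ _ ⟩
    h ℕ.+ (sum (heights r hs) ℕ.+ (area t ℕ.+ areas (subtrees r)))
  ≡⟨ cong (h ℕ.+_) (x∙yz≈y∙xz (sum (heights r hs)) (area t) _) ⟩
    h ℕ.+ (area t ℕ.+ (sum (heights r hs) ℕ.+ areas (subtrees r)))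
  ≡⟨ cong (λ a → h ℕ.+ (area t ℕ.+ a)) (area-heights r hs) ⟩
    h ℕ.+ (area t ℕ.+ (riseArea r ℕ.+ sum hs))
  ≡⟨ cong (h ℕ.+_) (sym (ℕP.+-assoc (area t) (riseArea r) (sum hs))) ⟩
    h ℕ.+ ((area t ℕ.+ riseArea r) ℕ.+ sum hs)
  ≡⟨ sym (ℕP.+-assoc h _ _) ⟩
    (h ℕ.+ (area t ℕ.+ riseArea r)) ℕ.+ sum hs
  ∎
  where open ≡-Reasoning

area-decode : ∀ c → area (decode c) ≡ stackCodeArea c
area-decode (p , r , d) = begin
    sum (heights r (suc p ∷ parts d)) ℕ.+ areas (subtrees r)
  ≡⟨ area-heights r (suc p ∷ parts d) ⟩
    riseArea r ℕ.+ (suc p ℕ.+ sum (parts d))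
  ≡⟨ cong (λ a → riseArea r ℕ.+ (suc p ℕ.+ a)) (sum-parts d) ⟩
    riseArea r ℕ.+ (suc p ℕ.+ partitionArea d)
  ≡⟨ x∙yz≈y∙xz (riseArea r) (suc p) (partitionArea d) ⟩
    suc p ℕ.+ (riseArea r ℕ.+ partitionArea d)
  ∎
  where open ≡-Reasoning

codeArea : ⊤ ⊎ StackCode → ℕ
codeArea = [ (λ _ → 0) , stackCodeArea ]′

Tree↔-area : ∀ t → codeArea (Inverse.to Tree↔⊤⊎StackCode t) ≡ area t
Tree↔-area (node _ emptyPoly [])           = refl
Tree↔-area t@(node n (stack hs pos st) ts) =
  trans (sym (area-decode (suffixCode (encodeSuffix 1 (head-positive pos st) pos st ts)))) (cong area (Inverse.strictlyInverseʳ Tree↔⊤⊎StackCode t))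

-- Counting trees by area

RisesOfArea : ℕ → ℕ → ℕ → Set
RisesOfArea hi lo = Fibre (Rise hi lo) riseArea

PartitionsOfArea : ℕ → ℕ → Set
PartitionsOfArea hi = Fibre (Partition hi) partitionArea

PartitionsOfArea-zero : ∀ A → PartitionsOfArea 0 A ↔ Point A
PartitionsOfArea-zero = Fibre-↔ Partition-zero
  (λ { pnil → refl ; (pcons h 1≤h h≤0 _) → ⊥-elim (ℕP.<-irrefl refl (ℕP.≤-trans (recompute-≤ 1≤h) (recompute-≤ h≤0))) })

PartitionsOfArea-suc : ∀ h A → PartitionsOfArea (suc h) A ↔ (PartitionsOfArea h A ⊎ Shift (suc h) A (PartitionsOfArea (suc h)))
PartitionsOfArea-suc h A = ↔-trans (Fibre-↔ (Partition-split h) (Partition-split-area h) A)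
  (↔-trans (Fibre-⊎ partitionArea _ A) (↔-refl ⊎-cong Fibre-shift partitionArea (suc h) A))

RisesOfArea-empty : ∀ hi lo A → hi ≤ lo → RisesOfArea hi lo A ↔ Point A
RisesOfArea-empty hi lo A hi≤lo = Fibre-↔ (Rise-empty hi lo hi≤lo)
  (λ { rnil → refl
     ; (rcons h lo≤h h<hi _ _) → ⊥-elim (ℕP.<-irrefl refl
         (ℕP.<-≤-trans (recompute-≤ h<hi) (ℕP.≤-trans hi≤lo (recompute-≤ lo≤h)))) }) A

RisesOfArea-split : ∀ hi lo A → lo < hi →
  RisesOfArea hi lo A ↔ (RisesOfArea hi (suc lo) A ⊎ Shift lo A (Convolution TreesOfArea (RisesOfArea hi lo)))
RisesOfArea-split hi lo A lo<hi = ↔-trans (Fibre-↔ (Rise-split hi lo lo<hi) (Rise-split-area hi lo lo<hi) A)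
  (↔-trans (Fibre-⊎ riseArea _ A)
    (↔-refl ⊎-cong ↔-trans (Fibre-shift (λ (t , r) → area t ℕ.+ riseArea r) lo A) (Shift-cong (Fibre-× area riseArea))))

StackCodesOfPeak : ℕ → ℕ → Set
StackCodesOfPeak A p = Shift (suc p) A (Convolution (RisesOfArea (suc p) 1) (PartitionsOfArea (suc p)))

-- A stack code of area A has peak height suc p ≤ A.
StackCodesOfArea : ∀ A → Fibre StackCode stackCodeArea A ↔ Below A (StackCodesOfPeak A)
StackCodesOfArea A = ↔-trans byPeak (Below-cong (λ p →
  ↔-trans (Fibre-shift (λ (r , d) → riseArea r ℕ.+ partitionArea d) (suc p) A) (Shift-cong (Fibre-× riseArea partitionArea))))
  where
  byPeak : Fibre StackCode stackCodeArea A ↔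
           Below A (λ p → Fibre (Rise (suc p) 1 × Partition (suc p)) (λ (r , d) → suc p ℕ.+ (riseArea r ℕ.+ partitionArea d)) A)
  byPeak = mk↔ₛ′
    (λ { ((p , r , d) , e) → below p (subst (suc p ≤_) e (ℕP.m≤m+n (suc p) _)) ((r , d) , e) })
    (λ { (below p _ ((r , d) , e)) → (p , r , d) , e })
    (λ _ → refl)
    (λ _ → refl)

TreesOfArea-split : ∀ A → TreesOfArea A ↔ (Point A ⊎ Below A (StackCodesOfPeak A))
TreesOfArea-split A = ↔-trans (Fibre-↔ Tree↔⊤⊎StackCode Tree↔-area A)
  (↔-trans (Fibre-⊎ (λ _ → 0) stackCodeArea A) (↔-refl ⊎-cong StackCodesOfArea A))

private
  ∸-<-pred : ∀ {A k f} → 1 ≤ k → k ≤ A → A < suc f → A ∸ k < f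
  ∸-<-pred {A} {k} 1≤k k≤A A<1+f = ℕP.<-≤-trans (ℕP.∸-monoʳ-< {A} {k} {0} 1≤k k≤A) (ℕP.≤-pred A<1+f)

-- The fuel f bounds the areas involved; every decomposition step lowers the area.
finite-Partitions : ∀ f hi A → A < f → Finite (PartitionsOfArea hi A)
finite-Partitions (suc f) zero    A A<f = Finite-↔ (↔-sym (PartitionsOfArea-zero A)) (Finite-Point A)
finite-Partitions (suc f) (suc h) A A<f = Finite-↔ (↔-sym (PartitionsOfArea-suc h A))
  (Finite-⊎ (finite-Partitions (suc f) h A A<f)
    (Finite-Shift (suc h) A _ (λ h<A → finite-Partitions f (suc h) (A ∸ suc h) (∸-<-pred (s≤s z≤n) h<A A<f))))

finite-Rises : ∀ f → (∀ m → m < f → Finite (TreesOfArea m)) →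
               ∀ g lo → 1 ≤ lo → ∀ A → A < f → Finite (RisesOfArea (lo ℕ.+ g) lo A)
finite-Rises (suc f) trees zero lo 1≤lo A A<f =
  Finite-↔ (↔-sym (RisesOfArea-empty (lo ℕ.+ 0) lo A (ℕP.≤-reflexive (ℕP.+-identityʳ lo)))) (Finite-Point A)
finite-Rises (suc f) trees (suc g) lo 1≤lo A A<f =
  Finite-↔ (↔-sym (RisesOfArea-split (lo ℕ.+ suc g) lo A (ℕP.m<m+n lo (s≤s z≤n))))
    (Finite-⊎ higher (Finite-Shift lo A _ (λ lo≤A → Finite-Below (suc (A ∸ lo)) _ (λ j j≤ →
      Finite-× (trees j (ℕP.<-trans (ℕP.≤-<-trans (ℕP.≤-pred j≤) (∸-<-pred 1≤lo lo≤A A<f)) (ℕP.n<1+n f)))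
               (finite-Rises f (λ m m<f → trees m (ℕP.m<n⇒m<1+n m<f)) (suc g) lo 1≤lo (A ∸ lo ∸ j)
                  (ℕP.≤-<-trans (ℕP.m∸n≤m (A ∸ lo) j) (∸-<-pred 1≤lo lo≤A A<f)))))))
  where
  higher : Finite (RisesOfArea (lo ℕ.+ suc g) (suc lo) A)
  higher = subst (λ hi → Finite (RisesOfArea hi (suc lo) A)) (sym (ℕP.+-suc lo g))
    (finite-Rises (suc f) trees g (suc lo) (ℕP.m≤n⇒m≤1+n 1≤lo) A A<f)

finite-Trees : ∀ f A → A < f → Finite (TreesOfArea A)
finite-Trees (suc f) A A<f = Finite-↔ (↔-sym (TreesOfArea-split A))
  (Finite-⊎ (Finite-Point A) (Finite-Below A _ (λ p _ → Finite-Shift (suc p) A _ (λ p<A →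
    Finite-Below (suc (A ∸ suc p)) _ (λ j j≤ →
      Finite-× (finite-Rises f (finite-Trees f) p 1 ℕP.≤-refl j (ℕP.≤-<-trans (ℕP.≤-pred j≤) (∸-<-pred (s≤s z≤n) p<A A<f)))
               (finite-Partitions (suc A) (suc p) (A ∸ suc p ∸ j)
                  (s≤s (ℕP.≤-trans (ℕP.m∸n≤m (A ∸ suc p) j) (ℕP.m∸n≤m A (suc p))))))))))

GF : ∀ {F : ℕ → Set} → (∀ A → Finite (F A)) → PS
GF fin A = + size (fin A)

GF-unique : ∀ {F : ℕ → Set} (fin fin′ : ∀ A → Finite (F A)) → GF fin ≗ GF fin′
GF-unique fin fin′ A = cong +_ (size-unique (fin A) (fin′ A))

GF-Point : GF Finite-Point ≗ one
GF-Point zero    = refl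
GF-Point (suc A) = refl

GF-⊎ : ∀ {F G : ℕ → Set} (fin : ∀ A → Finite (F A)) (fin′ : ∀ A → Finite (G A)) →
       GF (λ A → Finite-⊎ (fin A) (fin′ A)) ≗ GF fin ⊕ GF fin′
GF-⊎ fin fin′ A = ℤP.pos-+ (size (fin A)) (size (fin′ A))

GF-Shift : ∀ k {F : ℕ → Set} (fin : ∀ A → Finite (F A)) →
           GF (λ A → Finite-Shift k A F (λ _ → fin (A ∸ k))) ≗ shift k (GF fin)
GF-Shift k fin A = size-Shift k A _ _ (λ m → size (fin m)) (λ _ → refl)

Finite-Convolution : ∀ {F G : ℕ → Set} → (∀ j → Finite (F j)) → (∀ j → Finite (G j)) → ∀ m → Finite (Convolution F G m)
Finite-Convolution fin fin′ m = Finite-Below (suc m) _ (λ j _ → Finite-× (fin j) (fin′ (m ∸ j)))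

GF-Convolution : ∀ {F G : ℕ → Set} (fin : ∀ j → Finite (F j)) (fin′ : ∀ j → Finite (G j)) →
                 GF (Finite-Convolution fin fin′) ≗ GF fin ⊛ GF fin′
GF-Convolution fin fin′ m = trans
  (size-Below (suc m) _ _ (λ j → GF fin j * GF fin′ (m ∸ j)) (λ j _ → ℤP.pos-* (size (fin j)) (size (fin′ (m ∸ j)))))
  (sumBelow-suc m _)

finite-TreesOfArea : ∀ A → Finite (TreesOfArea A)
finite-TreesOfArea A = finite-Trees (suc A) A ℕP.≤-refl

finite-PartitionsOfArea : ∀ hi A → Finite (PartitionsOfArea hi A)
finite-PartitionsOfArea hi A = finite-Partitions (suc A) hi A ℕP.≤-refl

-- Rises from lo + 1 on: finiteness needs columns of positive height.
finite-RisesOfArea : ∀ hi lo A → Finite (RisesOfArea hi (suc lo) A)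
finite-RisesOfArea hi lo A with hi ≤? suc lo
... | yes hi≤ = Finite-↔ (↔-sym (RisesOfArea-empty hi (suc lo) A hi≤)) (Finite-Point A)
... | no hi≰  = subst (λ hi → Finite (RisesOfArea hi (suc lo) A)) (ℕP.m+[n∸m]≡n (ℕP.<⇒≤ (ℕP.≰⇒> hi≰)))
  (finite-Rises (suc A) (λ m _ → finite-TreesOfArea m) (hi ∸ suc lo) (suc lo) (s≤s z≤n) A ℕP.≤-refl)

treeGF : PS
treeGF = GF finite-TreesOfArea

partitionGF : ℕ → PS
partitionGF hi = GF (finite-PartitionsOfArea hi)

riseGF : ℕ → ℕ → PS
riseGF hi lo = GF (finite-RisesOfArea hi lo)

partitionGF-zero : partitionGF 0 ≗ one
partitionGF-zero = PS.trans
  (GF-unique (finite-PartitionsOfArea 0) (λ A → Finite-↔ (↔-sym (PartitionsOfArea-zero A)) (Finite-Point A))) GF-Point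

partitionGF-suc : ∀ h → partitionGF (suc h) ≗ partitionGF h ⊕ shift (suc h) (partitionGF (suc h))
partitionGF-suc h = PS.trans
  (GF-unique (finite-PartitionsOfArea (suc h)) (λ A → Finite-↔ (↔-sym (PartitionsOfArea-suc h A))
    (Finite-⊎ (finite-PartitionsOfArea h A) (Finite-Shift (suc h) A _ (λ _ → finite-PartitionsOfArea (suc h) (A ∸ suc h))))))
  (PS.trans (GF-⊎ (finite-PartitionsOfArea h) (λ A → Finite-Shift (suc h) A _ (λ _ → finite-PartitionsOfArea (suc h) (A ∸ suc h))))
    (PS.+-cong (PS.refl {partitionGF h}) (GF-Shift (suc h) (finite-PartitionsOfArea (suc h)))))

riseGF-empty : ∀ hi lo → hi ≤ suc lo → riseGF hi lo ≗ one
riseGF-empty hi lo hi≤ = PS.trans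
  (GF-unique (finite-RisesOfArea hi lo) (λ A → Finite-↔ (↔-sym (RisesOfArea-empty hi (suc lo) A hi≤)) (Finite-Point A))) GF-Point

riseGF-split : ∀ hi lo → suc lo < hi → riseGF hi lo ≗ riseGF hi (suc lo) ⊕ shift (suc lo) (treeGF ⊛ riseGF hi lo)
riseGF-split hi lo lo<hi = PS.trans
  (GF-unique (finite-RisesOfArea hi lo) (λ A → Finite-↔ (↔-sym (RisesOfArea-split hi (suc lo) A lo<hi))
    (Finite-⊎ (finite-RisesOfArea hi (suc lo) A) (Finite-Shift (suc lo) A _ (λ _ → conv (A ∸ suc lo))))))
  (PS.trans (GF-⊎ (finite-RisesOfArea hi (suc lo)) (λ A → Finite-Shift (suc lo) A _ (λ _ → conv (A ∸ suc lo))))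
    (PS.+-cong (PS.refl {riseGF hi (suc lo)}) (PS.trans (GF-Shift (suc lo) conv)
      (λ A → shift-cong (suc lo) (GF-Convolution finite-TreesOfArea (finite-RisesOfArea hi lo)) A))))
  where
  conv = Finite-Convolution finite-TreesOfArea (finite-RisesOfArea hi lo)

treeGF-coefficient : ∀ A → treeGF A ≡ one A + sumBelow A (λ p → shift (suc p) (riseGF (suc p) 0 ⊛ partitionGF (suc p)) A)
treeGF-coefficient A = trans
  (GF-unique finite-TreesOfArea (λ A → Finite-↔ (↔-sym (TreesOfArea-split A))
    (Finite-⊎ (Finite-Point A) (Finite-Below A _ (λ p _ → Finite-Shift (suc p) A _ (λ _ → conv p (A ∸ suc p)))))) A)
  (trans (ℤP.pos-+ (size (Finite-Point A)) _) (cong₂ _+_ (GF-Point A)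
    (size-Below A _ _ _ (λ p _ → trans (GF-Shift (suc p) (conv p) A)
      (shift-cong (suc p) (GF-Convolution (finite-RisesOfArea (suc p) 0) (finite-PartitionsOfArea (suc p))) A)))))
  where
  conv : ∀ p → ∀ m → Finite (Convolution (RisesOfArea (suc p) 1) (PartitionsOfArea (suc p)) m)
  conv p = Finite-Convolution (finite-RisesOfArea (suc p) 0) (finite-PartitionsOfArea (suc p))

⊛-one-minus : ∀ F G P → F ≗ G ⊕ P ⊛ F → F ⊛ (one ⊖ P) ≗ G
⊛-one-minus F G P F≗ = PS.trans
  (solve 2 (λ F P → F :* (con (+ 1) :- P) := F :- P :* F) (λ _ → refl) F P)
  (PS.trans (PS.+-cong F≗ (PS.refl {negPS (P ⊛ F)}))
    (solve 3 (λ G P F → (G :+ P :* F) :- P :* F := G) (λ _ → refl) G P F))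

partitionGF-inverse : ∀ p → partitionGF p ⊛ Prod qFactor 1 p ≗ one
partitionGF-inverse zero    = PS.trans (PS.*-identityʳ (partitionGF 0)) partitionGF-zero
partitionGF-inverse (suc h) = begin
    partitionGF (suc h) ⊛ Prod qFactor 1 (suc h)
  ≈⟨ PS.*-cong (PS.refl {partitionGF (suc h)}) (Prod-snoc qFactor 1 h) ⟩
    partitionGF (suc h) ⊛ (Prod qFactor 1 h ⊛ qFactor (suc h))
  ≈⟨ solve 3 (λ D P F → D :* (P :* F) := (D :* F) :* P) (λ _ → refl) (partitionGF (suc h)) (Prod qFactor 1 h) (qFactor (suc h)) ⟩
    (partitionGF (suc h) ⊛ qFactor (suc h)) ⊛ Prod qFactor 1 h
  ≈⟨ PS.*-cong (⊛-one-minus (partitionGF (suc h)) (partitionGF h) (q^ (suc h))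
       (PS.trans (partitionGF-suc h) (PS.+-cong (PS.refl {partitionGF h}) (shift≗q^⊛ (suc h) (partitionGF (suc h))))))
       (PS.refl {Prod qFactor 1 h}) ⟩
    partitionGF h ⊛ Prod qFactor 1 h
  ≈⟨ partitionGF-inverse h ⟩
    one
  ∎
  where open SetoidReasoning PS.setoid

riseGF-inverse : ∀ p → riseGF (suc p) 0 ⊛ Prod (factor treeGF) 1 p ≗ one
riseGF-inverse p = inverse-from p 0
  where
  inverse-from : ∀ len lo → riseGF (suc lo ℕ.+ len) lo ⊛ Prod (factor treeGF) (suc lo) len ≗ one
  inverse-from zero      lo = PS.trans (PS.*-identityʳ (riseGF (suc lo ℕ.+ 0) lo)) (riseGF-empty (suc lo ℕ.+ 0) lo (ℕP.≤-reflexive (ℕP.+-identityʳ (suc lo))))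
  inverse-from (suc len) lo = begin
      R lo ⊛ (factor treeGF (suc lo) ⊛ rest)
    ≈⟨ PS.sym (PS.*-assoc (R lo) (factor treeGF (suc lo)) rest) ⟩
      (R lo ⊛ factor treeGF (suc lo)) ⊛ rest
    ≈⟨ PS.*-cong (⊛-one-minus (R lo) (R (suc lo)) (treeGF ⊛ q^ (suc lo)) R-split) (PS.refl {rest}) ⟩
      R (suc lo) ⊛ rest
    ≈⟨ PS.*-cong (λ A → cong (λ hi → riseGF hi (suc lo) A) (ℕP.+-suc (suc lo) len)) (PS.refl {rest}) ⟩
      riseGF (suc (suc lo) ℕ.+ len) (suc lo) ⊛ rest
    ≈⟨ inverse-from len (suc lo) ⟩
      one
    ∎
    where
    open SetoidReasoning PS.setoid
    R : ℕ → PS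
    R = riseGF (suc lo ℕ.+ suc len)
    rest : PS
    rest = Prod (factor treeGF) (suc (suc lo)) len
    R-split : R lo ≗ R (suc lo) ⊕ (treeGF ⊛ q^ (suc lo)) ⊛ R lo
    R-split = PS.trans (riseGF-split _ lo (s≤s (ℕP.m<m+n lo (s≤s z≤n))))
      (PS.+-cong (PS.refl {R (suc lo)}) (PS.trans (shift≗q^⊛ (suc lo) (treeGF ⊛ R lo))
        (solve 3 (λ Q T R → Q :* (T :* R) := (T :* Q) :* R) (λ _ → refl) (q^ (suc lo)) treeGF (R lo))))

-- Only stacks with peak ≤ A contribute to the coefficient of q^A.
treeGF-expansion : ∀ M → treeGF ≈[ suc M ] one ⊕ Sum (λ p → q^ p ⊛ (riseGF p 0 ⊛ partitionGF p)) 1 M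
treeGF-expansion M A A<1+M = trans (treeGF-coefficient A) (cong (λ x → one A + x) (sym (begin
    Sum (λ p → q^ p ⊛ (riseGF p 0 ⊛ partitionGF p)) 1 M A
  ≡⟨ Sum-coefficient _ 1 M A ⟩
    sumBelow M (λ p → (q^ (suc p) ⊛ (riseGF (suc p) 0 ⊛ partitionGF (suc p))) A)
  ≡⟨ sumBelow-cong M (λ p _ → sym (shift≗q^⊛ (suc p) (riseGF (suc p) 0 ⊛ partitionGF (suc p)) A)) ⟩
    sumBelow M F
  ≡⟨ cong (λ m → sumBelow m F) (sym (ℕP.m+[n∸m]≡n (ℕP.≤-pred A<1+M))) ⟩
    sumBelow (A ℕ.+ (M ∸ A)) F
  ≡⟨ sumBelow-extend A (M ∸ A) F (λ p A≤p → shift-below (suc p) _ A (s≤s A≤p)) ⟩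
    sumBelow A F
  ∎)))
  where
  open ≡-Reasoning
  F : ℕ → ℤ
  F p = shift (suc p) (riseGF (suc p) 0 ⊛ partitionGF (suc p)) A

-- The tree series is the unique root

treeGF-root : IsΘ₀Root treeGF
treeGF-root M = Truncated.Θ₀-vanishes-at M treeGF (λ p → riseGF p 0) partitionGF
  (treeGF-expansion M) riseGF-inverse partitionGF-inverse

isolate : ∀ a x s → a + (- x + s) ≡ + 0 → x ≡ a + s
isolate a x s e = trans (sym (ℤP.+-identityʳ x)) (trans (cong (λ y → x + y) (sym e)) (cancel a x s))
  where
  cancel : ∀ a x s → x + (a + (- x + s)) ≡ a + s
  cancel = solve-∀

-- The terms n ≥ 2 of Θ₀(−f) at q^A; they only involve coefficients of f below A.
higherTerms : PS → ℕ → ℤ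
higherTerms f zero    = + 0
higherTerms f (suc A) = sumTo A (λ n → shift (suc (suc n) C 2) (powPS (negPS f) (suc (suc n))) (suc A))

Θ₀-root-coefficient : ∀ f → IsΘ₀Root f → ∀ A → f A ≡ one A + higherTerms f A
Θ₀-root-coefficient f root zero = isolate (one 0) (f 0) (+ 0)
  (trans (cong (λ x → one 0 + x) (trans (ℤP.+-identityʳ (- f 0)) (sym (PS.*-identityʳ (negPS f) 0)))) (root 0))
Θ₀-root-coefficient f root (suc A) = isolate (one (suc A)) (f (suc A)) (higherTerms f (suc A))
  (trans (sym (trans (sumTo-head (suc A) F) (cong (λ x → F 0 + x) (trans (sumTo-head A (F ∘ suc))
    (cong (_+ higherTerms f (suc A)) (PS.*-identityʳ (negPS f) (suc A))))))) (root (suc A)))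
  where
  F : ℕ → ℤ
  F n = shift (n C 2) (powPS (negPS f) n) (suc A)


higherTerms-cong : ∀ {f g} A → f ≈[ A ] g → higherTerms f A ≡ higherTerms g A
higherTerms-cong zero    f≈g = refl
higherTerms-cong (suc A) f≈g = sumTo-cong A (λ n _ →
  shift-agree (suc (suc n) C 2) (subst (1 ≤_) (sym (C2-suc (suc n))) (s≤s z≤n))
    (pow-cong-≈ (suc (suc n)) (neg-cong-≈ f≈g)))
  where
  shift-agree : ∀ {A F G} k → 1 ≤ k → F ≈[ A ] G → shift k F A ≡ shift k G A
  shift-agree {A} k 1≤k F≈G with k ≤? A
  ... | yes k≤A = F≈G (A ∸ k) (ℕP.∸-monoʳ-< {A} {k} {0} 1≤k k≤A)
  ... | no _    = refl

Θ₀-roots-agree : ∀ f g → IsΘ₀Root f → IsΘ₀Root g → ∀ n → f ≈[ n ] g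
Θ₀-roots-agree f g root-f root-g (suc n) k k<1+n with k ℕ.≟ n
... | yes refl = begin
    f k                       ≡⟨ Θ₀-root-coefficient f root-f k ⟩
    one k + higherTerms f k   ≡⟨ cong (λ x → one k + x) (higherTerms-cong k (Θ₀-roots-agree f g root-f root-g k)) ⟩
    one k + higherTerms g k   ≡⟨ sym (Θ₀-root-coefficient g root-g k) ⟩
    g k                       ∎
  where open ≡-Reasoning
... | no k≢n = Θ₀-roots-agree f g root-f root-g n k (ℕP.≤∧≢⇒< (ℕP.≤-pred k<1+n) k≢n)

column : ∀ A → TreesOfArea A
column zero    = node 0 emptyPoly [] , refl
column (suc A) = node 0 (stack (suc A ∷ []) (s≤s z≤n ∷ []) (peak [-])) [] ,
  trans (ℕP.+-identityʳ _) (ℕP.+-identityʳ (suc A))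

theorem1 : Σ (ℕ → ℕ) (λ c →
             (∀ A → Fin (c A) ↔ TreesOfArea A)
             × IsΘ₀Root (λ A → + (c A))
             × (∀ f → IsΘ₀Root f → ∀ A → f A ≡ + (c A))
             × (∀ A → 1 ≤ c A))
theorem1 = treeCount , (λ A → proj₂ (finite-TreesOfArea A)) , treeGF-root
         , (λ f root-f A → Θ₀-roots-agree f treeGF root-f treeGF-root (suc A) A ℕP.≤-refl)
         , (λ A → nonempty (Inverse.from (proj₂ (finite-TreesOfArea A)) (column A)))
  where
  treeCount : ℕ → ℕ
  treeCount A = size (finite-TreesOfArea A)
  nonempty : ∀ {n} → Fin n → 1 ≤ n
  nonempty Fin.zero    = s≤s z≤n
  nonempty (Fin.suc _) = s≤s z≤n
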